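{- We have $$A^{1\underline{23}}(x,q)=1+I^{1\underline{23}}(x,q)+\frac{x}{1-xq}\left[\left(A^{1\underline{23}}(x,q)-1\right)xq+x\right].$$ Also, $$I^{1\underline{23}}(x)=\frac{1-x-x^2}{1-x}B(x)-1,$$ where $B(x)=\sum_{n\ge0}B_nx^n$ and $B_n$ is the $n$-th Bell number (the number of set partitions of $[n]$). Moreover, $I^{1\underline{23}}_1=1$ and for $n\ge2$, $$I^{1\underline{23}}_n=B_n-\sum_{i=0}^{n-2}B_i.$$
   Context: For a permutation $\pi=\pi_1\cdots\pi_n$ of $[n]$, let $i_\pi$ be the smallest index $i$ with $\{\pi_1,\dots,\pi_i\}=\{1,\dots,i\}$; $\pi$ is indecomposable if $i_\pi=n$ (the empty permutation is not indecomposable). A permutation $\pi$ contains the vincular pattern $1\underline{23}$ if there are indices $j<k<n$ with $\pi_j<\pi_k<\pi_{k+1}$; otherwise it avoids it. A descent of $\pi$ is an index $i$ with $\pi_i>\pi_{i+1}$. For a pattern $\sigma$, $A^\sigma_{n,i}$ (resp. $I^\sigma_{n,i}$) is the number of $\sigma$-avoiding permutations (resp. $\sigma$-avoiding indecomposable permutations) of $[n]$ with $i$ descents; $A^\sigma(x,q)=1+\sum_{n\ge1}\sum_iA^\sigma_{n,i}x^nq^i$, $I^\sigma(x,q)=\sum_{n\ge1}\sum_iI^\sigma_{n,i}x^nq^i$, $I^\sigma(x)=I^\sigma(x,1)=\sum_{n\ge1}I^\sigma_nx^n$. -}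

module Defs where

open import Data.Nat as ℕ using (ℕ; zero; suc; _<_; _≤_; _<?_; _≤?_)
open import Data.Nat.Properties using (_≟_)
open import Data.Integer as ℤ using (ℤ; +_)
open import Data.List using (List; []; _∷_; map; concatMap; filter; length; take; upTo)
open import Data.Nat.ListAction using (sum)
open import Data.List.Relation.Unary.All using (All)
open import Data.List.Relation.Unary.All.Properties using ()
import Data.List.Relation.Unary.All as All
open import Data.List.Relation.Unary.Any using (Any)
import Data.List.Relation.Unary.Any as Any
open import Data.List.Relation.Unary.Unique.DecPropositional _≟_ using (Unique; unique?)
open import Data.List.Membership.DecPropositional _≟_ using (_∈_; _∈?_)
open import Data.Product using (Σ; _×_; _,_; proj₁; proj₂)
open import Relation.Binary.PropositionalEquality using (_≡_)
open import Relation.Nullary using (¬_; Dec; yes; no)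
open import Relation.Nullary.Decidable using (_×-dec_; ¬?)
open import Relation.Unary using (Decidable)

-- Permutations of [n] = {1,…,n}, written in one-line notation as lists

[1‥_] : ℕ → List ℕ
[1‥ n ] = map suc (upTo n)

words : List ℕ → ℕ → List (List ℕ)
words xs zero    = [] ∷ []
words xs (suc k) = concatMap (λ w → map (_∷ w) xs) (words xs k)

perms : ℕ → List (List ℕ)
perms n = filter unique? (words [1‥ n ] n)

des : List ℕ → ℕ
des []      = 0
des (a ∷ π) = go a π
  where
  go : ℕ → List ℕ → ℕ
  go a []      = 0
  go a (b ∷ π) with b <? a
  ... | yes _ = suc (go b π)
  ... | no  _ = go b π

-- The vincular pattern 1(23): indices j < k < n with π_j < π_k < π_{k+1}

splits : List ℕ → List (List ℕ × List ℕ)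
splits []      = ([] , []) ∷ []
splits (x ∷ π) = ([] , x ∷ π) ∷ map (λ p → (x ∷ proj₁ p , proj₂ p)) (splits π)

-- an occurrence at the split xs ++ ys: ys = π_k π_{k+1} …, and some
-- π_j in xs (so j < k) with π_j < π_k < π_{k+1}
OccAt : List ℕ × List ℕ → Set
OccAt (xs , [])         = Data.Empty.⊥ where import Data.Empty
OccAt (xs , b ∷ [])     = Data.Empty.⊥ where import Data.Empty
OccAt (xs , b ∷ c ∷ ys) = Any (_< b) xs × b < c

occAt? : Decidable OccAt
occAt? (xs , [])         = no (λ ())
occAt? (xs , b ∷ [])     = no (λ ())
occAt? (xs , b ∷ c ∷ ys) = Any.any? (_<? b) xs ×-dec (b <? c)

Contains123 : List ℕ → Set
Contains123 π = Any OccAt (splits π)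

contains123? : Decidable Contains123
contains123? π = Any.any? occAt? (splits π)

Avoids123 : List ℕ → Set
Avoids123 π = ¬ Contains123 π

avoids123? : Decidable Avoids123
avoids123? π = ¬? (contains123? π)

PrefixInit : ℕ → List ℕ → Set
PrefixInit i π = All (_∈ take i π) [1‥ i ] × All (_∈ [1‥ i ]) (take i π)

prefixInit? : (i : ℕ) → Decidable (PrefixInit i)
prefixInit? i π = All.all? (_∈? take i π) [1‥ i ] ×-dec All.all? (_∈? [1‥ i ]) (take i π)

-- π (of length n) is indecomposable iff i_π = n, i.e. n ≥ 1 and no
-- i with 1 ≤ i < n has {π_1,…,π_i} = {1,…,i}  (i = n always works).
Indecomposable : List ℕ → Set
Indecomposable π = 1 ≤ length π × All (λ i → ¬ PrefixInit (suc i) π) (upTo (length π ℕ.∸ 1))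

indecomposable? : Decidable Indecomposable
indecomposable? π = (1 ≤? length π) ×-dec All.all? (λ i → ¬? (prefixInit? (suc i) π)) (upTo (length π ℕ.∸ 1))

Acount : ℕ → ℕ → ℕ
Acount n i = length (filter (λ π → avoids123? π ×-dec (des π ≟ i)) (perms n))

Icount : ℕ → ℕ → ℕ
Icount n i = length (filter (λ π → (avoids123? π ×-dec indecomposable? π) ×-dec (des π ≟ i)) (perms n))

Icount₁ : ℕ → ℕ
Icount₁ n = length (filter (λ π → avoids123? π ×-dec indecomposable? π) (perms n))

-- two variables: f n i = coefficient of x^n q^i
FPS₂ : Set
FPS₂ = ℕ → ℕ → ℤ

-- one variable: f n = coefficient of x^n
FPS₁ : Set
FPS₁ = ℕ → ℤ

Σ≤ : ℕ → (ℕ → ℤ) → ℤ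
Σ≤ zero    f = f zero
Σ≤ (suc n) f = Σ≤ n f ℤ.+ f (suc n)

δ : ℕ → ℕ → ℤ
δ m n with m ≟ n
... | yes _ = + 1
... | no  _ = + 0

infixl 6 _⊕₂_ _⊖₂_ _⊕₁_ _⊖₁_
infixl 7 _⊛₂_ _⊛₁_

_⊕₂_ _⊖₂_ _⊛₂_ : FPS₂ → FPS₂ → FPS₂
(f ⊕₂ g) n i = f n i ℤ.+ g n i
(f ⊖₂ g) n i = f n i ℤ.- g n i
(f ⊛₂ g) n i = Σ≤ n (λ a → Σ≤ i (λ b → f a b ℤ.* g (n ℕ.∸ a) (i ℕ.∸ b)))

one₂ X₂ Q₂ : FPS₂
one₂ n i = δ n 0 ℤ.* δ i 0
X₂   n i = δ n 1 ℤ.* δ i 0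
Q₂   n i = δ n 0 ℤ.* δ i 1

-- 1/(1 - xq) = Σ_{k≥0} x^k q^k
inv1-xq : FPS₂
inv1-xq n i = δ n i

_⊕₁_ _⊖₁_ _⊛₁_ : FPS₁ → FPS₁ → FPS₁
(f ⊕₁ g) n = f n ℤ.+ g n
(f ⊖₁ g) n = f n ℤ.- g n
(f ⊛₁ g) n = Σ≤ n (λ a → f a ℤ.* g (n ℕ.∸ a))

one₁ X₁ : FPS₁
one₁ n = δ n 0
X₁   n = δ n 1

-- 1/(1 - x) = Σ_{k≥0} x^k
inv1-x : FPS₁
inv1-x n = + 1

_≋₂_ : FPS₂ → FPS₂ → Set
f ≋₂ g = ∀ n i → f n i ≡ g n i

_≋₁_ : FPS₁ → FPS₁ → Set
f ≋₁ g = ∀ n → f n ≡ g n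

-- A(x,q) = 1 + Σ_{n≥1} Σ_i A_{n,i} x^n q^i
Agf : FPS₂
Agf zero    i = δ i 0
Agf (suc n) i = + Acount (suc n) i

-- I(x,q) = Σ_{n≥1} Σ_i I_{n,i} x^n q^i
Igf : FPS₂
Igf zero    i = + 0
Igf (suc n) i = + Icount (suc n) i

-- I(x) = I(x,1) = Σ_{n≥1} I_n x^n
Igf₁ : FPS₁
Igf₁ zero    = + 0
Igf₁ (suc n) = + Icount₁ (suc n)

-- Bell numbers: B_n = Σ_k S(n,k), S = Stirling numbers of the 2nd kind
-- (S(n,k) = number of partitions of [n] into k blocks)

stirling2 : ℕ → ℕ → ℕ
stirling2 zero    zero    = 1
stirling2 zero    (suc k) = 0
stirling2 (suc n) zero    = 0
stirling2 (suc n) (suc k) = suc k ℕ.* stirling2 n (suc k) ℕ.+ stirling2 n k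

bell : ℕ → ℕ
bell n = sum (map (stirling2 n) (upTo (suc n)))

Bgf : FPS₁
Bgf n = + bell n

-- Scanning π from left to right, π avoids 1(23) iff every entry that is not a
-- left-to-right minimum is followed by a smaller entry (module Avoidance).  Inserting
-- the largest letter n+1 into an avoider of [n], either in front or directly after one
-- of its left-to-right minima, produces every avoider of [n+1] exactly once; so the
-- avoiders of [n] with k left-to-right minima are counted by S(n,k), and all avoiders by
-- the Bell number B_n (module LeftToRightMinima).  A decomposable avoider of [n] is
-- (τ+1) 1 n (n-1) … (j+2) for a unique avoider τ of [j], j ≤ n-2 (module Decomposable);
-- it has n-2 descents if τ is empty and des τ + n-j-1 otherwise.  Splitting the avoiders
-- into indecomposable and decomposable ones gives
--   A_{n,i} = I_{n,i} + [i = n-2] + Σ_{1≤j≤n-2} A_{j,i-n+j+1}   and   B_n = I_n + Σ_{i≤n-2} B_i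
-- (module Counting).  The two generating-function identities
-- are these relations read coefficientwise, using only that multiplying by a monomial
-- shifts coefficients (modules Series, FirstEquation, SecondEquation).
module Submission where

open import Defs

module Sums where

  open import Data.Nat using (ℕ; suc; _+_; _*_)
  open import Data.Nat.Properties using (+-identityʳ; *-zeroʳ; *-suc; +-commutativeSemigroup)
  open import Algebra.Properties.CommutativeSemigroup +-commutativeSemigroup using (interchange)
  open import Data.List using (List; []; _∷_; _++_; map; filter; length; concatMap)
  open import Data.List.Properties using (map-++)
  open import Data.Nat.ListAction using (sum)
  open import Data.Nat.ListAction.Properties using (sum-++; sum-↭)
  open import Data.List.Relation.Unary.All as All using (All; []; _∷_)
  import Data.List.Relation.Unary.All.Properties as All
  open import Data.List.Relation.Unary.Any using (here; there)
  open import Data.List.Relation.Unary.Unique.Propositional using (Unique)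
  open import Data.List.Relation.Unary.AllPairs using ([]; _∷_)
  import Data.List.Relation.Unary.Unique.Propositional.Properties as Unique
  open import Data.List.Membership.Propositional using (_∈_; find; lose)
  open import Data.List.Membership.Propositional.Properties using (∈-concatMap⁺; ∈-concatMap⁻)
  open import Data.List.Membership.Propositional.Properties.WithK using (unique∧set⇒bag)
  open import Data.List.Relation.Binary.BagAndSetEquality using (∼bag⇒↭)
  import Data.List.Relation.Binary.Permutation.Propositional.Properties as Perm
  open import Data.Product using (Σ; _×_; _,_)
  open import Data.Empty using (⊥)
  open import Function.Bundles using (mk⇔)
  open import Relation.Nullary using (Dec; yes; no)
  open import Relation.Unary using (Decidable)
  open import Relation.Binary.PropositionalEquality using (_≡_; refl; sym; trans; cong; cong₂)

  𝟙 : ∀ {P : Set} → Dec P → ℕ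
  𝟙 (yes _) = 1
  𝟙 (no _)  = 0

  sumBy : ∀ {A : Set} → (A → ℕ) → List A → ℕ
  sumBy f xs = sum (map f xs)

  module _ {A : Set} where

    sumBy-++ : ∀ (f : A → ℕ) xs ys → sumBy f (xs ++ ys) ≡ sumBy f xs + sumBy f ys
    sumBy-++ f xs ys = trans (cong sum (map-++ f xs ys)) (sum-++ (map f xs) (map f ys))

    sumBy-cong : ∀ {f g : A → ℕ} xs → (∀ {x} → x ∈ xs → f x ≡ g x) → sumBy f xs ≡ sumBy g xs
    sumBy-cong []       f≡g = refl
    sumBy-cong (x ∷ xs) f≡g = cong₂ _+_ (f≡g (here refl)) (sumBy-cong xs (λ x∈ → f≡g (there x∈)))

    sumBy-+ : ∀ (f g : A → ℕ) xs → sumBy (λ x → f x + g x) xs ≡ sumBy f xs + sumBy g xs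
    sumBy-+ f g []       = refl
    sumBy-+ f g (x ∷ xs) = trans (cong (f x + g x +_) (sumBy-+ f g xs)) (interchange (f x) (g x) _ _)

    sumBy-const : ∀ c xs → sumBy (λ (_ : A) → c) xs ≡ c * length xs
    sumBy-const c []       = sym (*-zeroʳ c)
    sumBy-const c (x ∷ xs) = trans (cong (c +_) (sumBy-const c xs)) (sym (*-suc c (length xs)))

    sumBy-one : ∀ xs → sumBy (λ (_ : A) → 1) xs ≡ length xs
    sumBy-one []       = refl
    sumBy-one (x ∷ xs) = cong suc (sumBy-one xs)

    sumBy-filter : ∀ {P : A → Set} (P? : Decidable P) (f : A → ℕ) xs →
                   sumBy f (filter P? xs) ≡ sumBy (λ x → 𝟙 (P? x) * f x) xs
    sumBy-filter P? f []       = refl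
    sumBy-filter P? f (x ∷ xs) with P? x
    ... | yes _ = cong₂ _+_ (sym (+-identityʳ (f x))) (sumBy-filter P? f xs)
    ... | no  _ = sumBy-filter P? f xs

    length-filter : ∀ {P : A → Set} (P? : Decidable P) xs → length (filter P? xs) ≡ sumBy (λ x → 𝟙 (P? x)) xs
    length-filter P? []       = refl
    length-filter P? (x ∷ xs) with P? x
    ... | yes _ = cong suc (length-filter P? xs)
    ... | no  _ = length-filter P? xs

    -- Sums over two duplicate-free lists with the same members agree: such lists are
    -- permutations of each other.
    sumBy-sameMembers : ∀ (f : A → ℕ) {xs ys} → Unique xs → Unique ys →
                        (∀ {z} → z ∈ xs → z ∈ ys) → (∀ {z} → z ∈ ys → z ∈ xs) → sumBy f xs ≡ sumBy f ys
    sumBy-sameMembers f ux uy to from = sum-↭ (Perm.map⁺ f (∼bag⇒↭ (unique∧set⇒bag ux uy (mk⇔ to from))))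

  module _ {A B : Set} where

    sumBy-map : ∀ (f : B → ℕ) (g : A → B) xs → sumBy f (map g xs) ≡ sumBy (λ x → f (g x)) xs
    sumBy-map f g []       = refl
    sumBy-map f g (x ∷ xs) = cong (f (g x) +_) (sumBy-map f g xs)

    sumBy-concatMap : ∀ (f : B → ℕ) (g : A → List B) xs →
                      sumBy f (concatMap g xs) ≡ sumBy (λ x → sumBy f (g x)) xs
    sumBy-concatMap f g []       = refl
    sumBy-concatMap f g (x ∷ xs) =
      trans (sumBy-++ f (g x) (concatMap g xs)) (cong (sumBy f (g x) +_) (sumBy-concatMap f g xs))

    length-concatMap : ∀ (g : A → List B) xs → length (concatMap g xs) ≡ sumBy (λ x → length (g x)) xs
    length-concatMap g xs =
      trans (sym (sumBy-one (concatMap g xs)))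
            (trans (sumBy-concatMap (λ _ → 1) g xs) (sumBy-cong xs (λ {x} _ → sumBy-one (g x))))

    ∈-concatMap-intro : ∀ (g : A → List B) {xs x y} → x ∈ xs → y ∈ g x → y ∈ concatMap g xs
    ∈-concatMap-intro g x∈ y∈ = ∈-concatMap⁺ g (lose x∈ y∈)

    ∈-concatMap-elim : ∀ (g : A → List B) {xs y} → y ∈ concatMap g xs → Σ A λ x → x ∈ xs × y ∈ g x
    ∈-concatMap-elim g {xs} y∈ = find (∈-concatMap⁻ g {xs = xs} y∈)

    unique-map : ∀ {g : A → B} (h : B → A) {xs} → Unique xs → (∀ {x} → x ∈ xs → h (g x) ≡ x) → Unique (map g xs)
    unique-map h {[]}     u        inv = []
    unique-map h {x ∷ xs} (x∉ ∷ u) inv =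
      All.map⁺ (All.tabulate (λ {y} y∈ gx≡gy → All.lookup x∉ y∈ (trans (sym (inv (here refl)))
                                                   (trans (cong h gx≡gy) (inv (there y∈))))))
      ∷ unique-map h u (λ x∈ → inv (there x∈))

    unique-concatMap : ∀ {g : A → List B} (h : B → A) {xs} → Unique xs → (∀ {x} → x ∈ xs → Unique (g x)) →
                       (∀ {x y} → x ∈ xs → y ∈ g x → h y ≡ x) → Unique (concatMap g xs)
    unique-concatMap h {[]}     u        ug inv = []
    unique-concatMap {g} h {x ∷ xs} (x∉ ∷ u) ug inv =
      Unique.++⁺ (ug (here refl)) (unique-concatMap h u (λ x∈ → ug (there x∈)) (λ x∈ → inv (there x∈))) disjoint
      where
      disjoint : ∀ {y} → y ∈ g x × y ∈ concatMap g xs → ⊥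
      disjoint (y∈ , y∈′) with ∈-concatMap-elim g y∈′
      ... | x′ , x′∈ , y∈x′ = All.lookup x∉ x′∈ (trans (sym (inv (here refl) y∈)) (inv (there x′∈) y∈x′))

  module _ {A : Set} where

    unique-++ˡ : ∀ (xs : List A) {ys} → Unique (xs ++ ys) → Unique xs
    unique-++ˡ []       u        = []
    unique-++ˡ (x ∷ xs) (x∉ ∷ u) = All.++⁻ˡ xs x∉ ∷ unique-++ˡ xs u

    unique-++ʳ : ∀ (xs : List A) {ys} → Unique (xs ++ ys) → Unique ys
    unique-++ʳ []       u       = u
    unique-++ʳ (x ∷ xs) (_ ∷ u) = unique-++ʳ xs u

    unique-++-disjoint : ∀ (xs : List A) {ys z} → Unique (xs ++ ys) → z ∈ xs → z ∈ ys → ⊥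
    unique-++-disjoint (x ∷ xs) (x∉ ∷ _) (here refl) z∈ys = All.lookup (All.++⁻ʳ xs x∉) z∈ys refl
    unique-++-disjoint (x ∷ xs) (_ ∷ u)  (there z∈)  z∈ys = unique-++-disjoint xs u z∈ z∈ys

module Permutations where

  open Sums
  open import Data.Nat using (ℕ; zero; suc; _≤_; _<_; z≤n; s≤s)
  open import Data.Nat.Properties using (_≟_; ≤-refl; <-irrefl; m≤n⇒m≤1+n; ≤∧≢⇒<; ≤-pred; suc-injective)
  open import Data.List using (List; []; _∷_; _++_; map; length; upTo)
  open import Data.List.Properties using (length-map; length-upTo)
  open import Data.List.Relation.Unary.All as All using (All; []; _∷_)
  open import Data.List.Relation.Unary.Any using (here; there)
  open import Data.List.Relation.Unary.Unique.Propositional using (Unique)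
  open import Data.List.Relation.Unary.AllPairs using ([]; _∷_)
  import Data.List.Relation.Unary.Unique.Propositional.Properties as Unique
  open import Data.List.Relation.Unary.Unique.DecPropositional _≟_ using (unique?)
  open import Data.List.Membership.Propositional using (_∈_; _∉_)
  open import Data.List.Membership.Propositional.Properties using (∈-map⁺; ∈-map⁻; ∈-upTo⁺; ∈-upTo⁻; ∈-filter⁺; ∈-filter⁻; ∈-∃++)
  import Data.List.Membership.DecPropositional _≟_ as DecMembership
  open import Data.List.Relation.Binary.Permutation.Propositional using (_↭_; ↭-sym; ↭⇒↭ₛ)
  open import Data.List.Relation.Binary.Permutation.Propositional.Properties using (↭-length; All-resp-↭; ∈-resp-↭; shift)
  open import Data.List.Relation.Binary.Permutation.Setoid.Properties using (Unique-resp-↭)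
  open import Data.Product using (_×_; _,_)
  open import Data.Empty using (⊥-elim)
  open import Relation.Nullary using (yes; no)
  open import Relation.Binary.PropositionalEquality using (_≡_; _≢_; refl; sym; trans; cong; subst; setoid)

  IsPerm : ℕ → List ℕ → Set
  IsPerm n π = length π ≡ n × All (λ x → 1 ≤ x × x ≤ n) π × Unique π

  ∈-[1‥]⁻ : ∀ {n x} → x ∈ [1‥ n ] → 1 ≤ x × x ≤ n
  ∈-[1‥]⁻ x∈ with ∈-map⁻ suc x∈
  ... | y , y∈ , refl = s≤s z≤n , ∈-upTo⁻ y∈

  ∈-[1‥]⁺ : ∀ {n x} → 1 ≤ x → x ≤ n → x ∈ [1‥ n ]
  ∈-[1‥]⁺ {x = suc y} _ y<n = ∈-map⁺ suc (∈-upTo⁺ y<n)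

  length-[1‥] : ∀ n → length [1‥ n ] ≡ n
  length-[1‥] n = trans (length-map suc (upTo n)) (length-upTo n)

  unique-[1‥] : ∀ n → Unique [1‥ n ]
  unique-[1‥] n = Unique.map⁺ suc-injective (Unique.upTo⁺ n)

  ∈-words⁻ : ∀ xs k {w} → w ∈ words xs k → length w ≡ k × All (_∈ xs) w
  ∈-words⁻ xs zero    (here refl) = refl , []
  ∈-words⁻ xs (suc k) w∈ with ∈-concatMap-elim (λ w → map (_∷ w) xs) {words xs k} w∈
  ... | w , w∈′ , aw∈ with ∈-map⁻ (_∷ w) aw∈
  ... | a , a∈ , refl with ∈-words⁻ xs k w∈′
  ... | len , letters = cong suc len , a∈ ∷ letters

  ∈-words⁺ : ∀ xs k {w} → length w ≡ k → All (_∈ xs) w → w ∈ words xs k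
  ∈-words⁺ xs zero    {[]}    refl []         = here refl
  ∈-words⁺ xs (suc k) {a ∷ w} refl (a∈ ∷ w⊆) =
    ∈-concatMap-intro (λ w → map (_∷ w) xs) (∈-words⁺ xs k refl w⊆) (∈-map⁺ (_∷ w) a∈)

  unique-words : ∀ xs k → Unique xs → Unique (words xs k)
  unique-words xs zero    u = [] ∷ []
  unique-words xs (suc k) u =
    unique-concatMap tail (unique-words xs k u) (λ _ → unique-map head u (λ _ → refl)) (λ _ → tail-of)
    where
    head : List ℕ → ℕ
    head []      = 0
    head (a ∷ _) = a
    tail : List ℕ → List ℕ
    tail []      = []
    tail (_ ∷ w) = w
    tail-of : ∀ {w v} → v ∈ map (_∷ w) xs → tail v ≡ w
    tail-of {w} v∈ with ∈-map⁻ (_∷ w) v∈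
    ... | _ , _ , refl = refl

  ∈-perms⁻ : ∀ {n π} → π ∈ perms n → IsPerm n π
  ∈-perms⁻ {n} π∈ with ∈-filter⁻ unique? {xs = words [1‥ n ] n} π∈
  ... | π∈′ , u with ∈-words⁻ [1‥ n ] n π∈′
  ... | len , letters = len , All.map ∈-[1‥]⁻ letters , u

  ∈-perms⁺ : ∀ {n π} → IsPerm n π → π ∈ perms n
  ∈-perms⁺ {n} (len , bounds , u) =
    ∈-filter⁺ unique? (∈-words⁺ [1‥ n ] n len (All.map (λ (p , q) → ∈-[1‥]⁺ p q) bounds)) u

  unique-perms : ∀ n → Unique (perms n)
  unique-perms n = Unique.filter⁺ unique? (unique-words [1‥ n ] n (unique-[1‥] n))

  unique-⊆-length : ∀ {A : Set} {xs ys : List A} → Unique xs → (∀ {z} → z ∈ xs → z ∈ ys) → length xs ≤ length ys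
  unique-⊆-length {xs = []}     _        _    = z≤n
  unique-⊆-length {xs = x ∷ xs} {ys} (x∉ ∷ u) xs⊆ with ∈-∃++ (xs⊆ (here refl))
  ... | ys₁ , ys₂ , refl =
    subst (suc (length xs) ≤_) (sym (↭-length (shift x ys₁ ys₂))) (s≤s (unique-⊆-length u xs⊆rest))
    where
    xs⊆rest : ∀ {z} → z ∈ xs → z ∈ ys₁ ++ ys₂
    xs⊆rest z∈ with ∈-resp-↭ (shift x ys₁ ys₂) (xs⊆ (there z∈))
    ... | here refl = ⊥-elim (All.lookup x∉ z∈ refl)
    ... | there z∈′ = z∈′

  IsPerm-onto : ∀ {n π x} → IsPerm n π → 1 ≤ x → x ≤ n → x ∈ π
  IsPerm-onto {n} {π} {x} (len , bounds , u) 1≤x x≤n with DecMembership._∈?_ x π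
  ... | yes x∈ = x∈
  ... | no  x∉ with ∈-∃++ (∈-[1‥]⁺ {n} 1≤x x≤n)
  ... | ys₁ , ys₂ , split = ⊥-elim (<-irrefl refl (subst (_≤ length (ys₁ ++ ys₂)) lengths (unique-⊆-length u π⊆rest)))
    where
    ↭x∷rest : [1‥ n ] ↭ x ∷ ys₁ ++ ys₂
    ↭x∷rest = subst (_↭ x ∷ ys₁ ++ ys₂) (sym split) (shift x ys₁ ys₂)
    π⊆rest : ∀ {z} → z ∈ π → z ∈ ys₁ ++ ys₂
    π⊆rest z∈ with ∈-resp-↭ ↭x∷rest (let (p , q) = All.lookup bounds z∈ in ∈-[1‥]⁺ p q)
    ... | here refl = ⊥-elim (x∉ z∈)
    ... | there z∈′ = z∈′
    lengths : length π ≡ suc (length (ys₁ ++ ys₂))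
    lengths = trans len (trans (sym (length-[1‥] n)) (↭-length ↭x∷rest))

  IsPerm-< : ∀ {n π} → IsPerm n π → All (_< suc n) π
  IsPerm-< (_ , bounds , _) = All.map (λ (_ , x≤n) → s≤s x≤n) bounds

  IsPerm-resp-↭ : ∀ {n π σ} → π ↭ σ → IsPerm n π → IsPerm n σ
  IsPerm-resp-↭ π↭σ (len , bounds , u) =
    trans (sym (↭-length π↭σ)) len , All-resp-↭ π↭σ bounds , Unique-resp-↭ (setoid ℕ) (↭⇒↭ₛ π↭σ) u

  IsPerm-cons : ∀ {n π} → IsPerm n π → IsPerm (suc n) (suc n ∷ π)
  IsPerm-cons (len , bounds , u) =
    cong suc len ,
    (s≤s z≤n , ≤-refl) ∷ All.map (λ (p , q) → p , m≤n⇒m≤1+n q) bounds ,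
    All.map (λ (_ , x≤n) n+1≡x → <-irrefl (sym n+1≡x) (s≤s x≤n)) bounds ∷ u

  IsPerm-uncons : ∀ {n π} → IsPerm (suc n) (suc n ∷ π) → IsPerm n π
  IsPerm-uncons {n} (len , _ ∷ bounds , n+1∉ ∷ u) =
    suc-injective len , All.zipWith below (n+1∉ , bounds) , u
    where
    below : ∀ {x} → suc n ≢ x × (1 ≤ x × x ≤ suc n) → 1 ≤ x × x ≤ n
    below (n+1≢x , 1≤x , x≤n+1) = 1≤x , ≤-pred (≤∧≢⇒< x≤n+1 (λ x≡n+1 → n+1≢x (sym x≡n+1)))

  IsPerm-insert : ∀ {n} π₁ π₂ → IsPerm n (π₁ ++ π₂) → IsPerm (suc n) (π₁ ++ suc n ∷ π₂)
  IsPerm-insert {n} π₁ π₂ p = IsPerm-resp-↭ (↭-sym (shift (suc n) π₁ π₂)) (IsPerm-cons p)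

  IsPerm-delete : ∀ {n} π₁ π₂ → IsPerm (suc n) (π₁ ++ suc n ∷ π₂) → IsPerm n (π₁ ++ π₂)
  IsPerm-delete {n} π₁ π₂ p = IsPerm-uncons (IsPerm-resp-↭ (shift (suc n) π₁ π₂) p)

-- Avoidance of 1(23), recast as a left-to-right scan: π avoids 1(23) iff every entry
-- that is not a left-to-right minimum is larger than the entry following it.
module Avoidance where

  open import Data.Nat using (ℕ; _≤_; _<_; _≤?_)
  open import Data.Nat.Properties using (<-trans; ≤-<-trans; ≤⇒≯; ≰⇒>)
  open import Data.List using (List; []; _∷_; _++_; [_]; map)
  open import Data.List.Properties using (++-assoc; ++-identityʳ)
  open import Data.List.Relation.Unary.Any as Any using (Any; here; there)
  import Data.List.Relation.Unary.Any.Properties as Any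
  open import Data.List.Membership.Propositional using (_∈_; find; lose)
  open import Data.List.Membership.Propositional.Properties using (∈-map⁺; ∈-map⁻)
  open import Data.Product using (Σ; _×_; _,_; proj₁; proj₂)
  open import Data.Sum using (_⊎_; inj₁; inj₂)
  open import Data.Empty using (⊥-elim)
  open import Data.Unit using (⊤; tt)
  open import Function using (_∘_)
  open import Relation.Nullary using (¬_; yes; no)
  open import Relation.Binary.PropositionalEquality using (_≡_; refl; sym; cong)

  -- AvoidsFrom m π: π is the rest of a word whose part read so far has minimum m, and
  -- in π every entry exceeding the running minimum is not followed by a larger entry.
  -- (AvoidsAt m b π is the same condition for the word b ∷ π.)
  AvoidsAt : ℕ → ℕ → List ℕ → Set
  AvoidsAt m b []      = ⊤
  AvoidsAt m b (c ∷ π) with b ≤? m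
  ... | yes _ = AvoidsAt b c π
  ... | no  _ = ¬ b < c × AvoidsAt m c π

  AvoidsFrom : ℕ → List ℕ → Set
  AvoidsFrom m []      = ⊤
  AvoidsFrom m (b ∷ π) = AvoidsAt m b π

  Av : List ℕ → Set
  Av []      = ⊤
  Av (a ∷ π) = AvoidsFrom a π

  AvoidsFrom-min⁺ : ∀ {m b c π} → b ≤ m → AvoidsFrom b (c ∷ π) → AvoidsFrom m (b ∷ c ∷ π)
  AvoidsFrom-min⁺ {m} {b} b≤m av with b ≤? m
  ... | yes _   = av
  ... | no  b≰m = ⊥-elim (b≰m b≤m)

  AvoidsFrom-min⁻ : ∀ {m b c π} → b ≤ m → AvoidsFrom m (b ∷ c ∷ π) → AvoidsFrom b (c ∷ π)
  AvoidsFrom-min⁻ {m} {b} b≤m av with b ≤? m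
  ... | yes _   = av
  ... | no  b≰m = ⊥-elim (b≰m b≤m)

  AvoidsFrom-big⁺ : ∀ {m b c π} → ¬ b ≤ m → ¬ b < c → AvoidsFrom m (c ∷ π) → AvoidsFrom m (b ∷ c ∷ π)
  AvoidsFrom-big⁺ {m} {b} b≰m b≮c av with b ≤? m
  ... | yes b≤m = ⊥-elim (b≰m b≤m)
  ... | no  _   = b≮c , av

  AvoidsFrom-big⁻ : ∀ {m b c π} → ¬ b ≤ m → AvoidsFrom m (b ∷ c ∷ π) → ¬ b < c × AvoidsFrom m (c ∷ π)
  AvoidsFrom-big⁻ {m} {b} b≰m av with b ≤? m
  ... | yes b≤m = ⊥-elim (b≰m b≤m)
  ... | no  _   = av

  -- An occurrence of 1(23) in π whose '1' may also be taken from the word pre read before π.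
  OccursAfter : List ℕ → List ℕ → Set
  OccursAfter pre π = Any (λ (xs , ys) → OccAt (pre ++ xs , ys)) (splits π)

  occAt-subst : ∀ {xs xs′ ys} → xs ≡ xs′ → OccAt (xs , ys) → OccAt (xs′ , ys)
  occAt-subst refl o = o

  occursAfter-cons⁻ : ∀ pre b π → OccursAfter pre (b ∷ π) → OccAt (pre , b ∷ π) ⊎ OccursAfter (pre ++ [ b ]) π
  occursAfter-cons⁻ pre b π (here o)   = inj₁ (occAt-subst (++-identityʳ pre) o)
  occursAfter-cons⁻ pre b π (there os) =
    inj₂ (Any.map (λ {p} → occAt-subst (sym (++-assoc pre [ b ] (proj₁ p)))) (Any.map⁻ os))

  occursAfter-cons⁺ : ∀ pre b π → OccAt (pre , b ∷ π) ⊎ OccursAfter (pre ++ [ b ]) π → OccursAfter pre (b ∷ π)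
  occursAfter-cons⁺ pre b π (inj₁ o)  = here (occAt-subst (sym (++-identityʳ pre)) o)
  occursAfter-cons⁺ pre b π (inj₂ os) =
    there (Any.map⁺ (Any.map (λ {p} → occAt-subst (++-assoc pre [ b ] (proj₁ p))) os))

  later : ∀ {pre b π} → OccursAfter (pre ++ [ b ]) π → OccursAfter pre (b ∷ π)
  later {pre} {b} {π} occ = occursAfter-cons⁺ pre b π (inj₂ occ)

  occursAfter-[] : ∀ pre → ¬ OccursAfter pre []
  occursAfter-[] pre (here ())
  occursAfter-[] pre (there ())

  -- m is the minimum of pre, as far as comparisons from below are concerned.
  MinOf : List ℕ → ℕ → Set
  MinOf pre m = ∀ {b} → (Any (_< b) pre → m < b) × (m < b → Any (_< b) pre)

  minOf-new : ∀ {pre m b} → b ≤ m → MinOf pre m → MinOf (pre ++ [ b ]) b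
  minOf-new {pre} {m} {b} b≤m min = new , (λ b<c → Any.++⁺ʳ pre (here b<c))
    where
    new : ∀ {c} → Any (_< c) (pre ++ [ b ]) → b < c
    new any with Any.++⁻ pre any
    ... | inj₁ x<c        = ≤-<-trans b≤m (proj₁ min x<c)
    ... | inj₂ (here b<c) = b<c

  minOf-old : ∀ {pre m b} → m < b → MinOf pre m → MinOf (pre ++ [ b ]) m
  minOf-old {pre} {m} {b} m<b min = old , (λ m<c → Any.++⁺ˡ (proj₂ min m<c))
    where
    old : ∀ {c} → Any (_< c) (pre ++ [ b ]) → m < c
    old any with Any.++⁻ pre any
    ... | inj₁ x<c        = proj₁ min x<c
    ... | inj₂ (here b<c) = <-trans m<b b<c

  AvoidsAt-sound : ∀ pre m b π → MinOf pre m → AvoidsAt m b π → ¬ OccursAfter pre (b ∷ π)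
  AvoidsAt-sound pre m b [] min av occ with occursAfter-cons⁻ pre b [] occ
  ... | inj₁ ()
  ... | inj₂ occ′ = occursAfter-[] _ occ′
  AvoidsAt-sound pre m b (c ∷ π) min av occ with b ≤? m | occursAfter-cons⁻ pre b (c ∷ π) occ
  ... | yes b≤m | inj₁ (x<b , _) = ≤⇒≯ b≤m (proj₁ min x<b)
  ... | yes b≤m | inj₂ occ′      = AvoidsAt-sound (pre ++ [ b ]) b c π (minOf-new b≤m min) av occ′
  ... | no  b≰m | inj₁ (_ , b<c) = proj₁ av b<c
  ... | no  b≰m | inj₂ occ′      = AvoidsAt-sound (pre ++ [ b ]) m c π (minOf-old (≰⇒> b≰m) min) (proj₂ av) occ′

  AvoidsAt-complete : ∀ pre m b π → MinOf pre m → ¬ OccursAfter pre (b ∷ π) → AvoidsAt m b π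
  AvoidsAt-complete pre m b []      min no-occ = tt
  AvoidsAt-complete pre m b (c ∷ π) min no-occ with b ≤? m
  ... | yes b≤m = AvoidsAt-complete (pre ++ [ b ]) b c π (minOf-new b≤m min) (no-occ ∘ later)
  ... | no  b≰m = (λ b<c → no-occ (occursAfter-cons⁺ pre b (c ∷ π) (inj₁ (proj₂ min (≰⇒> b≰m) , b<c))))
                , AvoidsAt-complete (pre ++ [ b ]) m c π (minOf-old (≰⇒> b≰m) min) (no-occ ∘ later)

  AvoidsFrom-sound : ∀ pre m π → MinOf pre m → AvoidsFrom m π → ¬ OccursAfter pre π
  AvoidsFrom-sound pre m []      min av = occursAfter-[] pre
  AvoidsFrom-sound pre m (b ∷ π) min av = AvoidsAt-sound pre m b π min av

  AvoidsFrom-complete : ∀ pre m π → MinOf pre m → ¬ OccursAfter pre π → AvoidsFrom m π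
  AvoidsFrom-complete pre m []      min no-occ = tt
  AvoidsFrom-complete pre m (b ∷ π) min no-occ = AvoidsAt-complete pre m b π min no-occ

  minOf-[_] : ∀ a → MinOf [ a ] a
  minOf-[ a ] = (λ { (here a<b) → a<b }) , here

  -- (no occurrence can start at the first letter)
  contains⇒occursAfter : ∀ a π → Contains123 (a ∷ π) → OccursAfter [ a ] π
  contains⇒occursAfter a []      (here ())
  contains⇒occursAfter a (c ∷ π) (here (() , _))
  contains⇒occursAfter a π       (there occ) = Any.map⁻ occ

  Av⇒avoids : ∀ π → Av π → Avoids123 π
  Av⇒avoids []      _  (here ())
  Av⇒avoids []      _  (there ())
  Av⇒avoids (a ∷ π) av occ = AvoidsFrom-sound [ a ] a π minOf-[ a ] av (contains⇒occursAfter a π occ)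

  avoids⇒Av : ∀ π → Avoids123 π → Av π
  avoids⇒Av []      _      = tt
  avoids⇒Av (a ∷ π) no-occ = AvoidsFrom-complete [ a ] a π minOf-[ a ] (λ occ → no-occ (there (Any.map⁺ occ)))

  Occurrence : List ℕ → Set
  Occurrence π = Σ (List ℕ) λ xs → Σ ℕ λ b → Σ ℕ λ c → Σ (List ℕ) λ ys →
                 π ≡ xs ++ b ∷ c ∷ ys × Any (_< b) xs × b < c

  splits-complete : ∀ xs ys → (xs , ys) ∈ splits (xs ++ ys)
  splits-complete []       []       = here refl
  splits-complete []       (y ∷ ys) = here refl
  splits-complete (x ∷ xs) ys       = there (∈-map⁺ _ (splits-complete xs ys))

  splits-sound : ∀ π {p} → p ∈ splits π → proj₁ p ++ proj₂ p ≡ π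
  splits-sound []      (here refl) = refl
  splits-sound (x ∷ π) (here refl) = refl
  splits-sound (x ∷ π) (there p∈) with ∈-map⁻ (λ p → (x ∷ proj₁ p , proj₂ p)) p∈
  ... | q , q∈ , refl = cong (x ∷_) (splits-sound π q∈)

  contains-intro : ∀ xs b c ys → Any (_< b) xs → b < c → Contains123 (xs ++ b ∷ c ∷ ys)
  contains-intro xs b c ys x<b b<c = lose (splits-complete xs (b ∷ c ∷ ys)) (x<b , b<c)

  contains-elim : ∀ π → Contains123 π → Occurrence π
  contains-elim π occ with find occ
  ... | (xs , b ∷ c ∷ ys) , p∈ , (x<b , b<c) = xs , b , c , ys , sym (splits-sound π p∈) , x<b , b<c

-- The avoiders of [n+1] with k+1 left-to-right minima arise,
-- each exactly once, from the avoiders of [n] either by prepending n+1 (k minima) or by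
-- inserting n+1 directly after one of their k+1 left-to-right minima.  Hence their number
-- satisfies the recurrence of the Stirling numbers S(n,k), and all avoiders of [n] are
-- counted by the Bell number B_n.
module LeftToRightMinima where

  open Sums
  open Permutations
  open Avoidance
  open import Data.Nat using (ℕ; zero; suc; _+_; _*_; _≤_; _<_; z≤n; s≤s; _≤?_)
  open import Data.Nat.Properties using (_≟_; ≤-trans; <-trans; <-≤-trans; <-irrefl; <⇒≤; ≤-refl; ≤-reflexive; m≤n⇒m≤1+n; +-comm)
  open import Data.List using (List; []; _∷_; _++_; map; length; concatMap; upTo; filter)
  open import Data.List.Properties using (length-++; length-map)
  open import Data.List.Relation.Unary.All as All using (All; []; _∷_)
  import Data.List.Relation.Unary.All.Properties as All
  open import Data.List.Relation.Unary.Any using (here; there)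
  open import Data.List.Relation.Unary.Unique.Propositional using (Unique)
  open import Data.List.Relation.Unary.AllPairs using ([]; _∷_)
  import Data.List.Relation.Unary.Unique.Propositional.Properties as Unique
  open import Data.List.Membership.Propositional using (_∈_; _∉_)
  open import Data.List.Membership.Propositional.Properties using (∈-map⁺; ∈-map⁻; ∈-++⁺ˡ; ∈-++⁺ʳ; ∈-++⁻; ∈-∃++; ∈-upTo⁺; ∈-filter⁺; ∈-filter⁻)
  open import Data.Product using (Σ; _×_; _,_; proj₁; proj₂)
  open import Data.Sum using (inj₁; inj₂)
  open import Data.Empty using (⊥-elim)
  open import Data.Unit using (tt)
  open import Relation.Nullary using (¬_; yes; no)
  open import Relation.Binary.PropositionalEquality using (_≡_; _≢_; refl; sym; trans; cong; cong₂; subst)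

  minimaFrom : ℕ → List ℕ → ℕ
  minimaFrom m []      = 0
  minimaFrom m (b ∷ π) with b ≤? m
  ... | yes _ = suc (minimaFrom b π)
  ... | no  _ = minimaFrom m π

  minima : List ℕ → ℕ
  minima []      = 0
  minima (a ∷ π) = suc (minimaFrom a π)

  insertsFrom : ℕ → ℕ → List ℕ → List (List ℕ)
  insertsFrom v m []      = []
  insertsFrom v m (b ∷ π) with b ≤? m
  ... | yes _ = (b ∷ v ∷ π) ∷ map (b ∷_) (insertsFrom v b π)
  ... | no  _ = map (b ∷_) (insertsFrom v m π)

  inserts : ℕ → List ℕ → List (List ℕ)
  inserts v []      = []
  inserts v (a ∷ π) = (a ∷ v ∷ π) ∷ map (a ∷_) (insertsFrom v a π)

  minimaFrom-min : ∀ {m b π} → b ≤ m → minimaFrom m (b ∷ π) ≡ suc (minimaFrom b π)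
  minimaFrom-min {m} {b} b≤m with b ≤? m
  ... | yes _   = refl
  ... | no  b≰m = ⊥-elim (b≰m b≤m)

  minimaFrom-big : ∀ {m b π} → ¬ b ≤ m → minimaFrom m (b ∷ π) ≡ minimaFrom m π
  minimaFrom-big {m} {b} b≰m with b ≤? m
  ... | yes b≤m = ⊥-elim (b≰m b≤m)
  ... | no  _   = refl

  minimaFrom-≤ : ∀ m π → minimaFrom m π ≤ length π
  minimaFrom-≤ m []      = z≤n
  minimaFrom-≤ m (b ∷ π) with b ≤? m
  ... | yes _ = s≤s (minimaFrom-≤ b π)
  ... | no  _ = m≤n⇒m≤1+n (minimaFrom-≤ m π)

  minima-≤ : ∀ π → minima π ≤ length π
  minima-≤ []      = z≤n
  minima-≤ (a ∷ π) = s≤s (minimaFrom-≤ a π)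

  length-insertsFrom : ∀ v m π → length (insertsFrom v m π) ≡ minimaFrom m π
  length-insertsFrom v m []      = refl
  length-insertsFrom v m (b ∷ π) with b ≤? m
  ... | yes _ = cong suc (trans (length-map (b ∷_) (insertsFrom v b π)) (length-insertsFrom v b π))
  ... | no  _ = trans (length-map (b ∷_) (insertsFrom v m π)) (length-insertsFrom v m π)

  length-inserts : ∀ v π → length (inserts v π) ≡ minima π
  length-inserts v []      = refl
  length-inserts v (a ∷ π) = cong suc (trans (length-map (a ∷_) (insertsFrom v a π)) (length-insertsFrom v a π))

  Av⇒AvoidsFrom : ∀ {m a π} → a ≤ m → Av (a ∷ π) → AvoidsFrom m (a ∷ π)
  Av⇒AvoidsFrom {π = []}    a≤m av = tt
  Av⇒AvoidsFrom {π = c ∷ π} a≤m av = AvoidsFrom-min⁺ a≤m av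

  AvoidsFrom⇒Av : ∀ {m a π} → a ≤ m → AvoidsFrom m (a ∷ π) → Av (a ∷ π)
  AvoidsFrom⇒Av {π = []}    a≤m av = tt
  AvoidsFrom⇒Av {π = c ∷ π} a≤m av = AvoidsFrom-min⁻ a≤m av

  Inserted : ℕ → List ℕ → List ℕ → Set
  Inserted v σ π = Σ ℕ λ x → Σ (List ℕ) λ pre → Σ (List ℕ) λ post →
                   σ ≡ x ∷ pre ++ post × π ≡ x ∷ pre ++ v ∷ post

  insertsFrom-inserted : ∀ v m σ {π} → π ∈ insertsFrom v m σ → Inserted v σ π
  insertsFrom-inserted v m (b ∷ σ) π∈ with b ≤? m
  insertsFrom-inserted v m (b ∷ σ) (here refl) | yes _ = b , [] , σ , refl , refl
  insertsFrom-inserted v m (b ∷ σ) (there π∈) | yes _ with ∈-map⁻ (b ∷_) π∈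
  ... | π′ , π′∈ , refl with insertsFrom-inserted v b σ π′∈
  ... | x , pre , post , refl , refl = b , x ∷ pre , post , refl , refl
  insertsFrom-inserted v m (b ∷ σ) π∈ | no _ with ∈-map⁻ (b ∷_) π∈
  ... | π′ , π′∈ , refl with insertsFrom-inserted v m σ π′∈
  ... | x , pre , post , refl , refl = b , x ∷ pre , post , refl , refl

  inserts-inserted : ∀ v σ {π} → π ∈ inserts v σ → Inserted v σ π
  inserts-inserted v (a ∷ σ) (here refl) = a , [] , σ , refl , refl
  inserts-inserted v (a ∷ σ) (there π∈) with ∈-map⁻ (a ∷_) π∈
  ... | π′ , π′∈ , refl with insertsFrom-inserted v a σ π′∈
  ... | x , pre , post , refl , refl = a , x ∷ pre , post , refl , refl

  inserted-head : ∀ {v c σ π} → Inserted v (c ∷ σ) π → Σ (List ℕ) λ π′ → π ≡ c ∷ π′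
  inserted-head (x , pre , post , refl , refl) = _ , refl

  max-not-min : ∀ {v b} → b < v → ¬ v ≤ b
  max-not-min b<v v≤b = <-irrefl refl (<-≤-trans b<v v≤b)

  max-not-below : ∀ {v c} → c < v → ¬ v < c
  max-not-below c<v v<c = <-irrefl refl (<-trans c<v v<c)

  insertsFrom-avoids : ∀ v m b σ {π} → All (_< v) (b ∷ σ) → AvoidsAt m b σ → π ∈ insertsFrom v m (b ∷ σ) → AvoidsFrom m π
  insertsFrom-avoids v m b σ below av π∈ with b ≤? m
  insertsFrom-avoids v m b [] below av (here refl) | yes b≤m = AvoidsFrom-min⁺ b≤m tt
  insertsFrom-avoids v m b (c ∷ σ) (b<v ∷ c<v ∷ _) av (here refl) | yes b≤m =
    AvoidsFrom-min⁺ b≤m (AvoidsFrom-big⁺ (max-not-min b<v) (max-not-below c<v) (AvoidsFrom-min⁻ b≤m av))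
  insertsFrom-avoids v m b σ below av (there π∈) | yes b≤m with ∈-map⁻ (b ∷_) π∈
  insertsFrom-avoids v m b (c ∷ σ) (_ ∷ below) av (there π∈) | yes b≤m | [] , π′∈ , refl = tt
  insertsFrom-avoids v m b (c ∷ σ) (_ ∷ below) av (there π∈) | yes b≤m | _ ∷ _ , π′∈ , refl =
    AvoidsFrom-min⁺ b≤m (insertsFrom-avoids v b c σ below (AvoidsFrom-min⁻ b≤m av) π′∈)
  insertsFrom-avoids v m b σ below av π∈ | no b≰m with ∈-map⁻ (b ∷_) π∈
  insertsFrom-avoids v m b (c ∷ σ) (_ ∷ below) av π∈ | no b≰m | π′ , π′∈ , refl
    with inserted-head (insertsFrom-inserted v m (c ∷ σ) π′∈)
  ... | _ , refl = AvoidsFrom-big⁺ b≰m (proj₁ (AvoidsFrom-big⁻ b≰m av))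
                     (insertsFrom-avoids v m c σ below (proj₂ (AvoidsFrom-big⁻ b≰m av)) π′∈)

  insertsFrom-minima : ∀ v m b σ {π} → All (_< v) (b ∷ σ) → π ∈ insertsFrom v m (b ∷ σ) →
                       minimaFrom m π ≡ minimaFrom m (b ∷ σ)
  insertsFrom-minima v m b σ below π∈ with b ≤? m
  insertsFrom-minima v m b σ (b<v ∷ _) (here refl) | yes b≤m =
    trans (minimaFrom-min b≤m) (cong suc (minimaFrom-big (max-not-min b<v)))
  insertsFrom-minima v m b σ below (there π∈) | yes b≤m with ∈-map⁻ (b ∷_) π∈
  insertsFrom-minima v m b (c ∷ σ) (_ ∷ below) (there π∈) | yes b≤m | _ , π′∈ , refl =
    trans (minimaFrom-min b≤m) (cong suc (insertsFrom-minima v b c σ below π′∈))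
  insertsFrom-minima v m b σ below π∈ | no b≰m with ∈-map⁻ (b ∷_) π∈
  insertsFrom-minima v m b (c ∷ σ) (_ ∷ below) π∈ | no b≰m | _ , π′∈ , refl =
    trans (minimaFrom-big b≰m) (insertsFrom-minima v m c σ below π′∈)

  inserts-avoids : ∀ v σ {π} → All (_< v) σ → Av σ → π ∈ inserts v σ → Av π
  inserts-avoids v (a ∷ [])    _                   av (here refl) = tt
  inserts-avoids v (a ∷ c ∷ σ) (a<v ∷ c<v ∷ _)     av (here refl) = AvoidsFrom-big⁺ (max-not-min a<v) (max-not-below c<v) av
  inserts-avoids v (a ∷ σ)     below               av (there π∈) with ∈-map⁻ (a ∷_) π∈
  inserts-avoids v (a ∷ c ∷ σ) (_ ∷ below)         av (there π∈) | _ , π′∈ , refl = insertsFrom-avoids v a c σ below av π′∈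

  inserts-minima : ∀ v σ {π} → All (_< v) σ → π ∈ inserts v σ → minima π ≡ minima σ
  inserts-minima v (a ∷ σ)     (a<v ∷ _)   (here refl) = cong suc (minimaFrom-big (max-not-min a<v))
  inserts-minima v (a ∷ σ)     below       (there π∈) with ∈-map⁻ (a ∷_) π∈
  inserts-minima v (a ∷ c ∷ σ) (_ ∷ below) (there π∈) | _ , π′∈ , refl = cong suc (insertsFrom-minima v a c σ below π′∈)

  insertsFrom-complete : ∀ v m b pre post → All (_< v) (b ∷ pre ++ post) → AvoidsAt m b (pre ++ v ∷ post) →
                         (b ∷ pre ++ v ∷ post) ∈ insertsFrom v m (b ∷ pre ++ post) × AvoidsAt m b (pre ++ post)
                         × minimaFrom m (b ∷ pre ++ v ∷ post) ≡ minimaFrom m (b ∷ pre ++ post)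
  insertsFrom-complete v m b [] post (b<v ∷ _) av with b ≤? m
  insertsFrom-complete v m b [] []       (b<v ∷ _) av | yes b≤m = here refl , tt , cong suc (minimaFrom-big (max-not-min b<v))
  insertsFrom-complete v m b [] (c ∷ σ) (b<v ∷ _) av | yes b≤m =
    here refl , AvoidsFrom-min⁺ b≤m (proj₂ (AvoidsFrom-big⁻ (max-not-min b<v) av)) , cong suc (minimaFrom-big (max-not-min b<v))
  ... | no _ = ⊥-elim (proj₁ av b<v)
  insertsFrom-complete v m b (c ∷ pre) post (_ ∷ below) av with b ≤? m
  ... | yes b≤m with insertsFrom-complete v b c pre post below av
  ...   | π∈ , av′ , same = there (∈-map⁺ (b ∷_) π∈) , av′ , cong suc same
  insertsFrom-complete v m b (c ∷ pre) post (_ ∷ below) av | no _ with insertsFrom-complete v m c pre post below (proj₂ av)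
  ... | π∈ , av′ , same = ∈-map⁺ (b ∷_) π∈ , (proj₁ av , av′) , same

  inserts-complete : ∀ v a pre post → All (_< v) (a ∷ pre ++ post) → Av (a ∷ pre ++ v ∷ post) →
                     (a ∷ pre ++ v ∷ post) ∈ inserts v (a ∷ pre ++ post) × Av (a ∷ pre ++ post)
                     × minima (a ∷ pre ++ v ∷ post) ≡ minima (a ∷ pre ++ post)
  inserts-complete v a [] []      (a<v ∷ _) av = here refl , tt , cong suc (minimaFrom-big (max-not-min a<v))
  inserts-complete v a [] (c ∷ σ) (a<v ∷ _) av =
    here refl , proj₂ (AvoidsFrom-big⁻ (max-not-min a<v) av) , cong suc (minimaFrom-big (max-not-min a<v))
  inserts-complete v a (c ∷ pre) post (_ ∷ below) av with insertsFrom-complete v a c pre post below av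
  ... | π∈ , av′ , same = there (∈-map⁺ (a ∷_) π∈) , av′ , cong suc same

  -- The insertions are pairwise distinct: they differ in the position of v.
  tail : List ℕ → List ℕ
  tail []      = []
  tail (_ ∷ π) = π

  second : List ℕ → ℕ
  second (_ ∷ x ∷ _) = x
  second _           = 0

  head-differs : ∀ {v b σ π} → All (_< v) σ → π ∈ insertsFrom v b σ → (b ∷ v ∷ σ) ≢ (b ∷ π)
  head-differs {σ = σ} below π∈ eq with insertsFrom-inserted _ _ σ π∈
  ... | x , pre , post , refl , refl = <-irrefl (sym (cong second eq)) (All.lookup below (here refl))

  unique-insertsFrom : ∀ v m σ → All (_< v) σ → Unique (insertsFrom v m σ)
  unique-insertsFrom v m []      below = []
  unique-insertsFrom v m (b ∷ σ) (_ ∷ below) with b ≤? m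
  ... | yes _ = All.map⁺ (All.tabulate (head-differs below)) ∷ unique-map tail (unique-insertsFrom v b σ below) (λ _ → refl)
  ... | no  _ = unique-map tail (unique-insertsFrom v m σ below) (λ _ → refl)

  unique-inserts : ∀ v σ → All (_< v) σ → Unique (inserts v σ)
  unique-inserts v []      below       = []
  unique-inserts v (a ∷ σ) (_ ∷ below) =
    All.map⁺ (All.tabulate (head-differs below)) ∷ unique-map tail (unique-insertsFrom v a σ below) (λ _ → refl)

  delete : ℕ → List ℕ → List ℕ
  delete v []      = []
  delete v (x ∷ π) with x ≟ v
  ... | yes _ = π
  ... | no  _ = x ∷ delete v π

  delete-insert : ∀ v pre post → v ∉ pre → delete v (pre ++ v ∷ post) ≡ pre ++ post
  delete-insert v []        post v∉ with v ≟ v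
  ... | yes _   = refl
  ... | no  v≢v = ⊥-elim (v≢v refl)
  delete-insert v (x ∷ pre) post v∉ with x ≟ v
  ... | yes refl = ⊥-elim (v∉ (here refl))
  ... | no  _    = cong (x ∷_) (delete-insert v pre post (λ v∈ → v∉ (there v∈)))

  minima-cons : ∀ v σ → All (_< v) σ → minima (v ∷ σ) ≡ suc (minima σ)
  minima-cons v []      below       = refl
  minima-cons v (a ∷ σ) (a<v ∷ _) = cong suc (minimaFrom-min (<⇒≤ a<v))

  Av-cons : ∀ v σ → All (_< v) σ → Av σ → Av (v ∷ σ)
  Av-cons v []      below     av = tt
  Av-cons v (a ∷ σ) (a<v ∷ _) av = Av⇒AvoidsFrom {π = σ} (<⇒≤ a<v) av

  Av-uncons : ∀ v σ → All (_< v) σ → Av (v ∷ σ) → Av σ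
  Av-uncons v []      below     av = tt
  Av-uncons v (a ∷ σ) (a<v ∷ _) av = AvoidsFrom⇒Av {π = σ} (<⇒≤ a<v) av

  byMinima : ℕ → ℕ → List (List ℕ)
  byMinima zero    zero    = [] ∷ []
  byMinima zero    (suc k) = []
  byMinima (suc n) zero    = []
  byMinima (suc n) (suc k) = map (suc n ∷_) (byMinima n k) ++ concatMap (inserts (suc n)) (byMinima n (suc k))

  byMinima-sound : ∀ n k {π} → π ∈ byMinima n k → IsPerm n π × Av π × minima π ≡ k
  byMinima-sound zero    zero    (here refl) = (refl , [] , []) , tt , refl
  byMinima-sound (suc n) (suc k) π∈ with ∈-++⁻ (map (suc n ∷_) (byMinima n k)) π∈
  ... | inj₁ π∈₁ with ∈-map⁻ (suc n ∷_) π∈₁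
  ...   | σ , σ∈ , refl with byMinima-sound n k σ∈
  ...     | p , av , mins =
    IsPerm-cons p , Av-cons (suc n) σ (IsPerm-< p) av , trans (minima-cons (suc n) σ (IsPerm-< p)) (cong suc mins)
  byMinima-sound (suc n) (suc k) π∈ | inj₂ π∈₂ with ∈-concatMap-elim (inserts (suc n)) {byMinima n (suc k)} π∈₂
  ... | σ , σ∈ , π∈σ with byMinima-sound n (suc k) σ∈ | inserts-inserted (suc n) σ π∈σ
  ...   | p , av , mins | x , pre , post , refl , refl =
    IsPerm-insert (x ∷ pre) post p , inserts-avoids (suc n) σ (IsPerm-< p) av π∈σ ,
    trans (inserts-minima (suc n) σ (IsPerm-< p) π∈σ) mins

  byMinima-complete : ∀ n {π} → IsPerm n π → Av π → π ∈ byMinima n (minima π)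
  byMinima-complete zero    {[]} p av = here refl
  byMinima-complete (suc n) {π} p av with ∈-∃++ (IsPerm-onto {x = suc n} p (s≤s z≤n) ≤-refl)
  ... | [] , post , refl with IsPerm-delete [] post p
  ...   | p′ = subst (λ k → (suc n ∷ post) ∈ byMinima (suc n) k) (sym (minima-cons (suc n) post (IsPerm-< p′)))
                 (∈-++⁺ˡ (∈-map⁺ (suc n ∷_) (byMinima-complete n p′ (Av-uncons (suc n) post (IsPerm-< p′) av))))
  byMinima-complete (suc n) {π} p av | x ∷ pre , post , refl with IsPerm-delete (x ∷ pre) post p
  ...   | p′ with inserts-complete (suc n) x pre post (IsPerm-< p′) av
  ...     | π∈ , av′ , same = subst (λ k → (x ∷ pre ++ suc n ∷ post) ∈ byMinima (suc n) k) (sym same)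
                 (∈-++⁺ʳ (map (suc n ∷_) (byMinima n (minimaFrom x (pre ++ post))))
                   (∈-concatMap-intro (inserts (suc n)) (byMinima-complete n p′ av′) π∈))

  unique-byMinima : ∀ n k → Unique (byMinima n k)
  unique-byMinima zero    zero    = [] ∷ []
  unique-byMinima zero    (suc k) = []
  unique-byMinima (suc n) zero    = []
  unique-byMinima (suc n) (suc k) =
    Unique.++⁺ (unique-map tail (unique-byMinima n k) (λ _ → refl))
               (unique-concatMap (delete (suc n)) (unique-byMinima n (suc k))
                  (λ σ∈ → unique-inserts (suc n) _ (IsPerm-< (proj₁ (byMinima-sound n (suc k) σ∈))))
                  deleted)
               disjoint
    where
    deleted : ∀ {σ π} → σ ∈ byMinima n (suc k) → π ∈ inserts (suc n) σ → delete (suc n) π ≡ σ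
    deleted {σ} σ∈ π∈ with inserts-inserted (suc n) σ π∈ | byMinima-sound n (suc k) σ∈
    ... | x , pre , post , refl , refl | p , _ =
      delete-insert (suc n) (x ∷ pre) post (λ n+1∈ → <-irrefl refl (All.lookup (IsPerm-< p) (∈-++⁺ˡ n+1∈)))
    disjoint : ∀ {π} → π ∈ map (suc n ∷_) (byMinima n k) × π ∈ concatMap (inserts (suc n)) (byMinima n (suc k)) → _
    disjoint (π∈₁ , π∈₂) with ∈-map⁻ (suc n ∷_) π∈₁ | ∈-concatMap-elim (inserts (suc n)) {byMinima n (suc k)} π∈₂
    ... | _ , _ , refl | σ , σ∈ , π∈σ with inserts-inserted (suc n) σ π∈σ | byMinima-sound n (suc k) σ∈
    ...   | x , pre , post , refl , refl | p , _ = <-irrefl refl (All.lookup (IsPerm-< p) (here refl))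

  -- |byMinima n k| = S(n,k), by the recurrence S(n+1,k+1) = S(n,k) + (k+1) S(n,k+1).
  length-byMinima : ∀ n k → length (byMinima n k) ≡ stirling2 n k
  length-byMinima zero    zero    = refl
  length-byMinima zero    (suc k) = refl
  length-byMinima (suc n) zero    = refl
  length-byMinima (suc n) (suc k) = begin
    length (map (suc n ∷_) (byMinima n k) ++ concatMap (inserts (suc n)) (byMinima n (suc k)))
      ≡⟨ length-++ (map (suc n ∷_) (byMinima n k)) ⟩
    length (map (suc n ∷_) (byMinima n k)) + length (concatMap (inserts (suc n)) (byMinima n (suc k)))
      ≡⟨ cong₂ _+_ (trans (length-map (suc n ∷_) (byMinima n k)) (length-byMinima n k)) insertions ⟩
    stirling2 n k + suc k * stirling2 n (suc k)
      ≡⟨ +-comm (stirling2 n k) _ ⟩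
    stirling2 (suc n) (suc k) ∎
    where
    open Relation.Binary.PropositionalEquality.≡-Reasoning
    insertions : length (concatMap (inserts (suc n)) (byMinima n (suc k))) ≡ suc k * stirling2 n (suc k)
    insertions =
      trans (length-concatMap (inserts (suc n)) (byMinima n (suc k)))
      (trans (sumBy-cong (byMinima n (suc k))
                (λ {σ} σ∈ → trans (length-inserts (suc n) σ) (proj₂ (proj₂ (byMinima-sound n (suc k) σ∈)))))
      (trans (sumBy-const (suc k) (byMinima n (suc k))) (cong (suc k *_) (length-byMinima n (suc k)))))

  allByMinima : ℕ → List (List ℕ)
  allByMinima n = concatMap (byMinima n) (upTo (suc n))

  unique-allByMinima : ∀ n → Unique (allByMinima n)
  unique-allByMinima n = unique-concatMap minima (Unique.upTo⁺ (suc n)) (λ {k} _ → unique-byMinima n k)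
                           (λ {k} _ π∈ → proj₂ (proj₂ (byMinima-sound n k π∈)))

  length-allByMinima : ∀ n → length (allByMinima n) ≡ bell n
  length-allByMinima n = trans (length-concatMap (byMinima n) (upTo (suc n)))
                               (sumBy-cong (upTo (suc n)) (λ {k} _ → length-byMinima n k))

  avoiders : ℕ → List (List ℕ)
  avoiders n = filter avoids123? (perms n)

  ∈-avoiders⁻ : ∀ {n π} → π ∈ avoiders n → IsPerm n π × Avoids123 π
  ∈-avoiders⁻ {n} π∈ with ∈-filter⁻ avoids123? {xs = perms n} π∈
  ... | π∈′ , avoids = ∈-perms⁻ π∈′ , avoids

  ∈-avoiders⁺ : ∀ {n π} → IsPerm n π → Avoids123 π → π ∈ avoiders n
  ∈-avoiders⁺ p avoids = ∈-filter⁺ avoids123? (∈-perms⁺ p) avoids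

  unique-avoiders : ∀ n → Unique (avoiders n)
  unique-avoiders n = Unique.filter⁺ avoids123? (unique-perms n)

  length-avoiders : ∀ n → length (avoiders n) ≡ bell n
  length-avoiders n = begin
    length (avoiders n)                    ≡⟨ sym (sumBy-one (avoiders n)) ⟩
    sumBy (λ _ → 1) (avoiders n)           ≡⟨ sumBy-sameMembers (λ _ → 1) (unique-avoiders n)
                                                (unique-allByMinima n) to from ⟩
    sumBy (λ _ → 1) (allByMinima n)        ≡⟨ sumBy-one (allByMinima n) ⟩
    length (allByMinima n)                 ≡⟨ length-allByMinima n ⟩
    bell n                                 ∎
    where
    open Relation.Binary.PropositionalEquality.≡-Reasoning
    to : ∀ {π} → π ∈ avoiders n → π ∈ allByMinima n
    to {π} π∈ with ∈-avoiders⁻ π∈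
    ... | p , avoids = ∈-concatMap-intro (byMinima n)
                         (∈-upTo⁺ (s≤s (≤-trans (minima-≤ π) (≤-reflexive (proj₁ p)))))
                         (byMinima-complete n p (avoids⇒Av π avoids))
    from : ∀ {π} → π ∈ allByMinima n → π ∈ avoiders n
    from {π} π∈ with ∈-concatMap-elim (byMinima n) {upTo (suc n)} π∈
    ... | k , _ , π∈k with byMinima-sound n k π∈k
    ... | p , av , _ = ∈-avoiders⁺ p (Av⇒avoids π av)

-- If π avoids 1(23) and {π_1,…,π_{j+1}} = {1,…,j+1} with j+1 < n,
-- then π_{j+1} = 1 and the remaining letters n, …, j+2 must appear in decreasing order.
-- So the decomposable avoiders of [n] are exactly the words (τ+1) 1 n (n-1) … (j+2) with τ
-- an avoider of [j], 0 ≤ j ≤ n-2, each arising once.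
module Decomposable where

  open Sums
  open Permutations
  open Avoidance
  open LeftToRightMinima using (avoiders; ∈-avoiders⁻; ∈-avoiders⁺; unique-avoiders)
  open import Data.Nat using (ℕ; zero; suc; _+_; _∸_; _≤_; _<_; _>_; z≤n; s≤s; _≤?_; pred)
  open import Data.Nat.Properties
    using (_≟_; ≤-trans; <-trans; <-≤-trans; ≤-<-trans; <-irrefl; <⇒≤; ≰⇒>; ≤-refl; ≤-reflexive; ≤-pred; ≤-antisym;
           suc-injective; m≤n⇒m≤1+n; m≤m+n; m≤n+m; m<m+n; +-comm; +-suc; m∸n+n≡m; m+n∸m≡n; ≮⇒≥; ≤∧≢⇒<; pred-mono-≤)
  open import Data.List using (List; []; _∷_; _++_; [_]; map; length; concatMap; upTo; take)
  open import Data.List.Properties using (++-assoc; ++-identityʳ; length-++; length-map; map-++; map-∘; map-id; map-id-local)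
  open import Data.List.Relation.Unary.All as All using (All; []; _∷_)
  import Data.List.Relation.Unary.All.Properties as All
  open import Data.List.Relation.Unary.Any as Any using (here; there)
  import Data.List.Relation.Unary.Any.Properties as Any
  open import Data.List.Relation.Unary.Linked using (Linked; []; [-]; _∷_)
  open import Data.List.Relation.Unary.Linked.Properties using (Linked⇒All; Linked⇒AllPairs)
  open import Data.List.Relation.Unary.Unique.Propositional using (Unique)
  open import Data.List.Relation.Unary.AllPairs as AllPairs using ([]; _∷_)
  import Data.List.Relation.Unary.Unique.Propositional.Properties as Unique
  open import Data.List.Membership.Propositional using (_∈_; find; lose)
  open import Data.List.Membership.Propositional.Properties using (∈-map⁺; ∈-map⁻; ∈-++⁺ˡ; ∈-++⁺ʳ; ∈-++⁻; ∈-upTo⁺; ∈-upTo⁻)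
  open import Data.Product using (Σ; _×_; _,_; proj₁; proj₂)
  open import Data.Sum using (inj₁; inj₂)
  open import Data.Empty using (⊥; ⊥-elim)
  open import Data.Unit using (tt)
  open import Relation.Nullary using (¬_; yes; no)
  open import Relation.Nullary.Decidable using (decidable-stable; ¬?)
  open import Relation.Binary.PropositionalEquality using (_≡_; _≢_; refl; sym; trans; cong; cong₂; subst)

  Descending : List ℕ → Set
  Descending = Linked _>_

  >-trans : ∀ {x y z} → x > y → y > z → x > z
  >-trans x>y y>z = <-trans y>z x>y

  descending-below-head : ∀ {x σ} → Descending (x ∷ σ) → All (_< x) σ
  descending-below-head [-]          = []
  descending-below-head (y<x ∷ desc) = Linked⇒All >-trans y<x desc

  unique-descending : ∀ {σ} → Descending σ → Unique σ
  unique-descending desc = AllPairs.map (λ y<x x≡y → <-irrefl (sym x≡y) y<x) (Linked⇒AllPairs >-trans desc)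

  descending-avoidsAt : ∀ m b σ → Descending (b ∷ σ) → AvoidsAt m b σ
  descending-avoidsAt m b []      _            = tt
  descending-avoidsAt m b (c ∷ σ) (c<b ∷ desc) with b ≤? m
  ... | yes _ = descending-avoidsAt b c σ desc
  ... | no  _ = (λ b<c → <-irrefl refl (<-trans b<c c<b)) , descending-avoidsAt m c σ desc

  descending-avoidsFrom : ∀ m σ → Descending σ → AvoidsFrom m σ
  descending-avoidsFrom m []      _    = tt
  descending-avoidsFrom m (b ∷ σ) desc = descending-avoidsAt m b σ desc

  run : ℕ → ℕ → List ℕ
  run a zero    = []
  run a (suc m) = suc (m + a) ∷ run a m

  run-descending : ∀ a m → Descending (run a m)
  run-descending a zero          = []
  run-descending a (suc zero)    = [-]
  run-descending a (suc (suc m)) = ≤-refl ∷ run-descending a (suc m)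

  length-run : ∀ a m → length (run a m) ≡ m
  length-run a zero    = refl
  length-run a (suc m) = cong suc (length-run a m)

  run-bounds : ∀ a m → All (λ x → a < x × x ≤ m + a) (run a m)
  run-bounds a zero    = []
  run-bounds a (suc m) = (s≤s (m≤n+m a m) , ≤-refl) ∷ All.map (λ (a<x , x≤) → a<x , m≤n⇒m≤1+n x≤) (run-bounds a m)

  -- A decreasing word of length m with letters in (a, m+a] is run a m.
  -- (the head of such a word is at least its length above a)
  descending-bounded-length : ∀ a x σ → Descending (x ∷ σ) → All (a <_) (x ∷ σ) → length σ + a < x
  descending-bounded-length a x []      _            (a<x ∷ _)   = a<x
  descending-bounded-length a x (y ∷ σ) (y<x ∷ desc) (_ ∷ above) = ≤-<-trans (descending-bounded-length a y σ desc above) y<x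

  descending-is-run : ∀ a σ → Descending σ → All (a <_) σ → All (_≤ length σ + a) σ → σ ≡ run a (length σ)
  descending-is-run a []      _    _           _           = refl
  descending-is-run a (x ∷ σ) desc (a<x ∷ above) (x≤ ∷ below) =
    cong₂ _∷_ (≤-antisym x≤ (descending-bounded-length a x σ desc (a<x ∷ above)))
              (descending-is-run a σ (Data.List.Relation.Unary.Linked.tail desc) above
                 (All.map (λ y<x → ≤-pred (≤-trans y<x x≤)) (descending-below-head desc)))

  glue : ℕ → ℕ → List ℕ → List ℕ
  glue j m τ = map suc τ ++ 1 ∷ run (suc j) m

  -- The decomposable avoiders of [n+1], by the length a+1 of the final decreasing run.
  decomposables : ℕ → List (List ℕ)
  decomposables zero    = []
  decomposables (suc n) = concatMap (λ a → map (glue (n ∸ suc a) (suc a)) (avoiders (n ∸ suc a))) (upTo n)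

  -- Gluing preserves avoidance: the prefix τ+1 is scanned as τ, then 1 is a new minimum.
  one-is-min : ∀ x σ → AvoidsFrom 1 σ → AvoidsAt (suc x) 1 σ
  one-is-min x []      av = tt
  one-is-min x (c ∷ σ) av = AvoidsFrom-min⁺ {c = c} {π = σ} (s≤s (z≤n {x})) av

  shifted-avoidsAt : ∀ m b τ σ → AvoidsAt m b τ → AvoidsFrom 1 σ → AvoidsAt (suc m) (suc b) (map suc τ ++ 1 ∷ σ)
  shifted-avoidsAt m b [] σ av av₁ with b ≤? m
  ... | yes b≤m = AvoidsFrom-min⁺ (s≤s b≤m) (one-is-min b σ av₁)
  ... | no  b≰m = AvoidsFrom-big⁺ (λ b≤ → b≰m (≤-pred b≤)) (λ { (s≤s ()) }) (one-is-min m σ av₁)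
  shifted-avoidsAt m b (c ∷ τ) σ av av₁ with b ≤? m
  ... | yes b≤m = AvoidsFrom-min⁺ (s≤s b≤m) (shifted-avoidsAt b c τ σ av av₁)
  ... | no  b≰m = AvoidsFrom-big⁺ (λ b≤ → b≰m (≤-pred b≤)) (λ b<c → proj₁ av (≤-pred b<c))
                                  (shifted-avoidsAt m c τ σ (proj₂ av) av₁)

  glue-avoids : ∀ τ σ → Av τ → Descending σ → Av (map suc τ ++ 1 ∷ σ)
  glue-avoids []          σ av desc = descending-avoidsFrom 1 σ desc
  glue-avoids (t ∷ [])    σ av desc = one-is-min t σ (descending-avoidsFrom 1 σ desc)
  glue-avoids (t ∷ c ∷ τ) σ av desc = shifted-avoidsAt t c τ σ av (descending-avoidsFrom 1 σ desc)

  length-glue : ∀ j m τ → length τ ≡ j → length (glue j m τ) ≡ suc (j + m)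
  length-glue j m τ len = begin
    length (map suc τ ++ 1 ∷ run (suc j) m)    ≡⟨ length-++ (map suc τ) ⟩
    length (map suc τ) + suc (length (run (suc j) m))
                                               ≡⟨ cong₂ (λ x y → x + suc y) (trans (length-map suc τ) len) (length-run (suc j) m) ⟩
    j + suc m                                  ≡⟨ +-suc j m ⟩
    suc (j + m)                                ∎
    where open Relation.Binary.PropositionalEquality.≡-Reasoning

  glue-isPerm : ∀ j m τ → IsPerm j τ → IsPerm (suc (j + m)) (glue j m τ)
  glue-isPerm j m τ (len , bounds , u) =
    length-glue j m τ len ,
    All.++⁺ (All.map⁺ (All.map (λ (_ , x≤j) → s≤s z≤n , s≤s (≤-trans x≤j (m≤m+n j m))) bounds))
            ((s≤s z≤n , s≤s z≤n) ∷ All.map (λ (j+1<x , x≤) → ≤-trans (s≤s z≤n) j+1<x , ≤-trans x≤ (≤-reflexive m+j+1≡))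
                                            (run-bounds (suc j) m)) ,
    Unique.++⁺ (Unique.map⁺ suc-injective u)
               (All.map (λ (j+1<x , _) 1≡x → <-irrefl 1≡x (≤-trans (s≤s (s≤s z≤n)) j+1<x)) (run-bounds (suc j) m)
                ∷ unique-descending (run-descending (suc j) m))
               disjoint
    where
    m+j+1≡ : m + suc j ≡ suc (j + m)
    m+j+1≡ = trans (+-suc m j) (cong suc (+-comm m j))
    disjoint : ∀ {x} → x ∈ map suc τ × x ∈ 1 ∷ run (suc j) m → ⊥
    disjoint (x∈τ , x∈rest) with ∈-map⁻ suc x∈τ
    ... | t , t∈ , refl with x∈rest
    ...   | here 1≡  = <-irrefl (sym 1≡) (s≤s (proj₁ (All.lookup bounds t∈)))
    ...   | there x∈ = <-irrefl refl (<-≤-trans (proj₁ (All.lookup (run-bounds (suc j) m) x∈)) (s≤s (proj₂ (All.lookup bounds t∈))))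

  Initial : ℕ → List ℕ → Set
  Initial k q = All (_∈ q) [1‥ k ] × All (_∈ [1‥ k ]) q

  take-snoc : ∀ (xs : List ℕ) y ys → take (suc (length xs)) (xs ++ y ∷ ys) ≡ xs ++ [ y ]
  take-snoc []       y ys = refl
  take-snoc (x ∷ xs) y ys = cong (x ∷_) (take-snoc xs y ys)

  glue-prefix : ∀ j m τ → IsPerm j τ → PrefixInit (suc j) (glue j m τ)
  glue-prefix j m τ p@(len , bounds , u) =
    subst (Initial (suc j)) (sym take≡) (subst (λ k → Initial (suc k) (map suc τ ++ [ 1 ])) lenτ+1 (covers , inside))
    where
    lenτ+1 : length (map suc τ) ≡ j
    lenτ+1 = trans (length-map suc τ) len
    take≡ : take (suc j) (glue j m τ) ≡ map suc τ ++ [ 1 ]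
    take≡ = subst (λ k → take (suc k) (glue j m τ) ≡ map suc τ ++ [ 1 ]) lenτ+1 (take-snoc (map suc τ) 1 (run (suc j) m))
    covers : All (_∈ map suc τ ++ [ 1 ]) [1‥ suc (length (map suc τ)) ]
    covers = All.tabulate (λ x∈ → letter _ (∈-[1‥]⁻ x∈))
      where
      letter : ∀ x → 1 ≤ x × x ≤ suc (length (map suc τ)) → x ∈ map suc τ ++ [ 1 ]
      letter (suc zero)    _             = ∈-++⁺ʳ (map suc τ) (here refl)
      letter (suc (suc y)) (_ , s≤s y<)  = ∈-++⁺ˡ (∈-map⁺ suc (IsPerm-onto p (s≤s z≤n) (subst (suc y ≤_) lenτ+1 y<)))
    inside : All (_∈ [1‥ suc (length (map suc τ)) ]) (map suc τ ++ [ 1 ])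
    inside = All.++⁺ (All.map⁺ (All.map (λ (_ , x≤j) → ∈-[1‥]⁺ (s≤s z≤n) (s≤s (subst (_ ≤_) (sym lenτ+1) x≤j))) bounds))
                     (∈-[1‥]⁺ (s≤s z≤n) (s≤s z≤n) ∷ [])

  glue-decomposable : ∀ j m τ → IsPerm j τ → ¬ Indecomposable (glue j (suc m) τ)
  glue-decomposable j m τ p (_ , noPrefix) = All.lookup noPrefix (∈-upTo⁺ j<) (glue-prefix j (suc m) τ p)
    where
    j< : j < length (glue j (suc m) τ) ∸ 1
    j< = subst (j <_) (cong (_∸ 1) (sym (trans (length-glue j (suc m) τ (proj₁ p)) (cong suc (+-suc j m)))))
               (s≤s (m≤m+n j m))

  decomposables-sound : ∀ n {π} → π ∈ decomposables n → IsPerm n π × Avoids123 π × ¬ Indecomposable π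
  decomposables-sound (suc n) {π} π∈
    with ∈-concatMap-elim (λ a → map (glue (n ∸ suc a) (suc a)) (avoiders (n ∸ suc a))) {upTo n} π∈
  ... | a , a∈ , π∈a with ∈-map⁻ (glue (n ∸ suc a) (suc a)) π∈a
  ... | τ , τ∈ , refl with ∈-avoiders⁻ τ∈
  ... | p , avoids =
    subst (λ k → IsPerm (suc k) (glue (n ∸ suc a) (suc a) τ)) (m∸n+n≡m (∈-upTo⁻ a∈)) (glue-isPerm (n ∸ suc a) (suc a) τ p) ,
    Av⇒avoids _ (glue-avoids τ _ (avoids⇒Av τ avoids) (run-descending _ (suc a))) ,
    glue-decomposable (n ∸ suc a) a τ p

  afterOne : List ℕ → ℕ
  afterOne []                = 0
  afterOne (zero ∷ π)        = afterOne π
  afterOne (suc zero ∷ π)    = length π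
  afterOne (suc (suc _) ∷ π) = afterOne π

  afterOne-glue : ∀ τ σ → All (1 ≤_) τ → afterOne (map suc τ ++ 1 ∷ σ) ≡ length σ
  afterOne-glue []          σ _            = refl
  afterOne-glue (suc t ∷ τ) σ (_ ∷ above) = afterOne-glue τ σ above

  take-length-++ : ∀ (xs ys : List ℕ) → take (length xs) (xs ++ ys) ≡ xs
  take-length-++ []       ys = refl
  take-length-++ (x ∷ xs) ys = cong (x ∷_) (take-length-++ xs ys)

  unglue : ∀ j m τ → length τ ≡ j → map pred (take j (glue j m τ)) ≡ τ
  unglue j m τ len = begin
    map pred (take j (glue j m τ))                     ≡⟨ cong (λ k → map pred (take k (glue j m τ))) (sym (trans (length-map suc τ) len)) ⟩
    map pred (take (length (map suc τ)) (glue j m τ))  ≡⟨ cong (map pred) (take-length-++ (map suc τ) _) ⟩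
    map pred (map suc τ)                               ≡⟨ sym (map-∘ τ) ⟩
    map (λ x → x) τ                                    ≡⟨ map-id τ ⟩
    τ                                                  ∎
    where open Relation.Binary.PropositionalEquality.≡-Reasoning

  unique-decomposables : ∀ n → Unique (decomposables n)
  unique-decomposables zero    = []
  unique-decomposables (suc n) =
    unique-concatMap (λ π → pred (afterOne π)) (Unique.upTo⁺ n)
      (λ {a} _ → unique-map (λ π → map pred (take (n ∸ suc a) π)) (unique-avoiders (n ∸ suc a))
                   (λ τ∈ → unglue _ _ _ (proj₁ (proj₁ (∈-avoiders⁻ τ∈)))))
      run-length
    where
    run-length : ∀ {a π} → a ∈ upTo n → π ∈ map (glue (n ∸ suc a) (suc a)) (avoiders (n ∸ suc a)) → pred (afterOne π) ≡ a
    run-length {a} _ π∈ with ∈-map⁻ (glue (n ∸ suc a) (suc a)) π∈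
    ... | τ , τ∈ , refl with ∈-avoiders⁻ {n ∸ suc a} τ∈
    ... | (_ , bounds , _) , _ = cong pred (trans (afterOne-glue τ _ (All.map proj₁ bounds)) (length-run _ (suc a)))

  proper-initial-prefix : ∀ n {π} → length π ≡ suc n → ¬ Indecomposable π → Σ ℕ λ i → i < n × PrefixInit (suc i) π
  proper-initial-prefix n {π} len notIndec
    with find (All.¬All⇒Any¬ (λ i → ¬? (prefixInit? (suc i) π)) (upTo (length π ∸ 1)) noProperPrefix)
    where
    noProperPrefix : ¬ All (λ i → ¬ PrefixInit (suc i) π) (upTo (length π ∸ 1))
    noProperPrefix none = notIndec (subst (1 ≤_) (sym len) (s≤s z≤n) , none)
  ... | i , i∈ , ¬¬init = i , subst (i <_) (cong (_∸ 1) len) (∈-upTo⁻ i∈) , decidable-stable (prefixInit? (suc i) π) ¬¬init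

  split-at : ∀ k (π : List ℕ) → k ≤ length π → Σ (List ℕ) λ p → Σ (List ℕ) λ s → π ≡ p ++ s × length p ≡ k × take k π ≡ p
  split-at zero    π       _       = [] , π , refl , refl , refl
  split-at (suc k) (x ∷ π) (s≤s k≤) with split-at k π k≤
  ... | p , s , refl , len , take≡ = x ∷ p , s , refl , cong suc len , cong (x ∷_) take≡

  split-last : ∀ (p : List ℕ) i → length p ≡ suc i → Σ (List ℕ) λ p′ → Σ ℕ λ ℓ → p ≡ p′ ++ [ ℓ ] × length p′ ≡ i
  split-last (x ∷ [])     zero    refl = [] , x , refl , refl
  split-last (x ∷ y ∷ p)  (suc i) len with split-last (y ∷ p) i (suc-injective len)
  ... | p′ , ℓ , split , len′ = x ∷ p′ , ℓ , cong (x ∷_) split , cong suc len′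

  descending-after-one : ∀ pre σ → 1 ∈ pre → All (1 <_) σ → Unique σ → Avoids123 (pre ++ σ) → Descending σ
  descending-after-one pre []          _   _            _                  _      = []
  descending-after-one pre (x ∷ [])    _   _            _                  _      = [-]
  descending-after-one pre (x ∷ y ∷ σ) 1∈ (1<x ∷ above) ((x≢y ∷ _) ∷ u) avoids =
    y<x ∷ descending-after-one (pre ++ [ x ]) (y ∷ σ) (∈-++⁺ˡ 1∈) above u avoids′
    where
    y<x : y < x
    y<x = ≤∧≢⇒< (≮⇒≥ (λ x<y → avoids (contains-intro pre x y σ (lose 1∈ 1<x) x<y))) (λ y≡x → x≢y (sym y≡x))
    avoids′ : Avoids123 ((pre ++ [ x ]) ++ y ∷ σ)
    avoids′ occ = avoids (subst Contains123 (++-assoc pre [ x ] (y ∷ σ)) occ)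

  shift-contains : ∀ τ σ → Contains123 τ → Contains123 (map suc τ ++ σ)
  shift-contains τ σ occ with contains-elim τ occ
  ... | xs , b , c , ys , refl , x<b , b<c =
    subst Contains123 (sym shifted)
      (contains-intro (map suc xs) (suc b) (suc c) (map suc ys ++ σ) (Any.map⁺ (Any.map s≤s x<b)) (s≤s b<c))
    where
    shifted : map suc (xs ++ b ∷ c ∷ ys) ++ σ ≡ map suc xs ++ suc b ∷ suc c ∷ (map suc ys ++ σ)
    shifted = trans (cong (_++ σ) (map-++ suc xs (b ∷ c ∷ ys))) (++-assoc (map suc xs) _ σ)

  after-initial-large : ∀ {n} k q s → IsPerm n (q ++ s) → All (_∈ q) [1‥ k ] → All (k <_) s
  after-initial-large k q s (_ , bounds , u) covers = All.tabulate above
    where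
    above : ∀ {x} → x ∈ s → k < x
    above {x} x∈ with x ≤? k
    ... | yes x≤k = ⊥-elim (unique-++-disjoint q u (All.lookup covers (∈-[1‥]⁺ (proj₁ (All.lookup bounds (∈-++⁺ʳ q x∈))) x≤k)) x∈)
    ... | no  x≰k = ≰⇒> x≰k

  -- The initial segment of a decomposable avoider ends with the letter 1: otherwise
  -- 1 … ℓ s₁ would be an occurrence of 1(23).
  initial-segment-ends-with-one : ∀ i p ℓ s₁ s → Initial (suc i) (p ++ [ ℓ ]) → suc i < s₁ →
                                  Avoids123 ((p ++ [ ℓ ]) ++ s₁ ∷ s) → ℓ ≡ 1
  initial-segment-ends-with-one i p ℓ s₁ s (covers , inside) i+1<s₁ avoids with ℓ ≟ 1
  ... | yes ℓ≡1 = ℓ≡1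
  ... | no  ℓ≢1 with ∈-++⁻ p (All.lookup covers (∈-[1‥]⁺ {suc i} (s≤s z≤n) (s≤s z≤n)))
  ...   | inj₂ (here 1≡ℓ) = ⊥-elim (ℓ≢1 (sym 1≡ℓ))
  ...   | inj₁ 1∈p        = ⊥-elim (avoids (subst Contains123 (sym (++-assoc p [ ℓ ] (s₁ ∷ s)))
                              (contains-intro p ℓ s₁ s (lose 1∈p 1<ℓ) (≤-<-trans (proj₂ ℓ-bounds) i+1<s₁))))
    where
    ℓ-bounds : 1 ≤ ℓ × ℓ ≤ suc i
    ℓ-bounds = ∈-[1‥]⁻ (All.lookup inside (∈-++⁺ʳ p (here refl)))
    1<ℓ : 1 < ℓ
    1<ℓ = ≤∧≢⇒< (proj₁ ℓ-bounds) (λ 1≡ℓ → ℓ≢1 (sym 1≡ℓ))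

  -- A decomposable avoider of [n+1] with initial segment p ++ [1] = {1, …, i+1} is
  -- glue i (a+1) τ, where τ = p − 1 and a+1 is the number of letters after 1.
  glued-shape : ∀ n i p s₁ s → length p ≡ i → IsPerm (suc n) ((p ++ [ 1 ]) ++ s₁ ∷ s) →
                Avoids123 ((p ++ [ 1 ]) ++ s₁ ∷ s) → Initial (suc i) (p ++ [ 1 ]) →
                ((p ++ [ 1 ]) ++ s₁ ∷ s) ∈ decomposables (suc n)
  glued-shape n i p s₁ s len perm@(lenπ , bounds , u) avoids (covers , inside) =
    subst (_∈ decomposables (suc n)) (sym π≡)
      (∈-concatMap-intro (λ a → map (glue (n ∸ suc a) (suc a)) (avoiders (n ∸ suc a))) (∈-upTo⁺ a<n)
        (subst (λ j → glue i (suc a) τ ∈ map (glue j (suc a)) (avoiders j)) (sym j≡i)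
          (∈-map⁺ (glue i (suc a)) (∈-avoiders⁺ τ-perm τ-avoids))))
    where
    open Relation.Binary.PropositionalEquality.≡-Reasoning
    a : ℕ
    a = length s
    large : All (suc i <_) (s₁ ∷ s)
    large = after-initial-large (suc i) (p ++ [ 1 ]) (s₁ ∷ s) perm covers
    suffix+i+1≡ : suc a + suc i ≡ suc n
    suffix+i+1≡ = begin
      suc a + suc i                              ≡⟨ +-comm (suc a) (suc i) ⟩
      suc i + suc a                              ≡⟨ cong (_+ suc a) (sym (trans (length-++ p) (trans (+-comm (length p) 1) (cong suc len)))) ⟩
      length (p ++ [ 1 ]) + length (s₁ ∷ s)      ≡⟨ sym (length-++ (p ++ [ 1 ])) ⟩
      length ((p ++ [ 1 ]) ++ s₁ ∷ s)            ≡⟨ lenπ ⟩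
      suc n                                      ∎
    a<n : a < n
    a<n = subst (a <_) (suc-injective suffix+i+1≡) (m<m+n a (s≤s z≤n))
    j≡i : n ∸ suc a ≡ i
    j≡i = trans (cong (_∸ suc a) (sym (trans (sym (+-suc a i)) (suc-injective suffix+i+1≡)))) (m+n∸m≡n (suc a) i)
    -- p consists of 2, …, i+1, so τ = p − 1 is a permutation of [i]
    up : Unique (p ++ [ 1 ])
    up = unique-++ˡ (p ++ [ 1 ]) u
    p-bounds : ∀ {x} → x ∈ p → 2 ≤ x × x ≤ suc i
    p-bounds {x} x∈ with ∈-[1‥]⁻ (All.lookup inside (∈-++⁺ˡ x∈))
    ... | 1≤x , x≤ = ≤∧≢⇒< 1≤x (λ 1≡x → unique-++-disjoint p up (subst (_∈ p) (sym 1≡x) x∈) (here refl)) , x≤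
    τ : List ℕ
    τ = map pred p
    p≡τ+1 : map suc τ ≡ p
    p≡τ+1 = trans (sym (map-∘ p)) (map-id-local (All.tabulate (λ x∈ → suc-pred (p-bounds x∈))))
      where
      suc-pred : ∀ {x} → 2 ≤ x × x ≤ suc i → suc (pred x) ≡ x
      suc-pred (s≤s (s≤s _) , _) = refl
    τ-perm : IsPerm i τ
    τ-perm = trans (length-map pred p) len ,
             All.map⁺ (All.tabulate (λ x∈ → pred-mono-≤ (proj₁ (p-bounds x∈)) , pred-mono-≤ (proj₂ (p-bounds x∈)))) ,
             Unique.map⁻ (subst Unique (sym p≡τ+1) (unique-++ˡ p up))
    π≡τ-glued : map suc τ ++ 1 ∷ s₁ ∷ s ≡ (p ++ [ 1 ]) ++ s₁ ∷ s
    π≡τ-glued = trans (cong (_++ 1 ∷ s₁ ∷ s) p≡τ+1) (sym (++-assoc p [ 1 ] (s₁ ∷ s)))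
    τ-avoids : Avoids123 τ
    τ-avoids occ = avoids (subst Contains123 π≡τ-glued (shift-contains τ (1 ∷ s₁ ∷ s) occ))
    -- after the letter 1 the word decreases, so it is the run (i+a+2) … (i+2)
    s-descending : Descending (s₁ ∷ s)
    s-descending = descending-after-one (p ++ [ 1 ]) (s₁ ∷ s) (∈-++⁺ʳ p (here refl))
                     (All.map (≤-<-trans (s≤s z≤n)) large) (unique-++ʳ (p ++ [ 1 ]) u) avoids
    s-bounded : All (_≤ suc a + suc i) (s₁ ∷ s)
    s-bounded = All.tabulate (λ {x} x∈ → subst (x ≤_) (sym suffix+i+1≡) (proj₂ (All.lookup bounds (∈-++⁺ʳ (p ++ [ 1 ]) x∈))))
    π≡ : (p ++ [ 1 ]) ++ s₁ ∷ s ≡ glue i (suc a) τ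
    π≡ = trans (sym π≡τ-glued) (cong (λ σ → map suc τ ++ 1 ∷ σ) (descending-is-run (suc i) (s₁ ∷ s) s-descending large s-bounded))

  decomposables-complete : ∀ n {π} → IsPerm (suc n) π → Avoids123 π → ¬ Indecomposable π → π ∈ decomposables (suc n)
  decomposables-complete n {π} perm@(lenπ , _ , _) avoids notIndec with proper-initial-prefix n lenπ notIndec
  ... | i , i<n , init with split-at (suc i) π (subst (suc i ≤_) (sym lenπ) (s≤s (<⇒≤ i<n)))
  ... | q , s , refl , len-q , take≡ with split-last q i len-q
  ... | p , ℓ , refl , len-p = after-segment ℓ s perm avoids (subst (Initial (suc i)) take≡ init) len-q
    where
    after-segment : ∀ ℓ s → IsPerm (suc n) ((p ++ [ ℓ ]) ++ s) → Avoids123 ((p ++ [ ℓ ]) ++ s) →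
                    Initial (suc i) (p ++ [ ℓ ]) → length (p ++ [ ℓ ]) ≡ suc i → ((p ++ [ ℓ ]) ++ s) ∈ decomposables (suc n)
    after-segment ℓ [] (lenπ′ , _) _ _ len-q′ =
      ⊥-elim (<-irrefl (suc-injective (trans (sym len-q′) (trans (cong length (sym (++-identityʳ (p ++ [ ℓ ])))) lenπ′))) i<n)
    after-segment ℓ (s₁ ∷ s) perm′ avoids′ init′ _
      with initial-segment-ends-with-one i p ℓ s₁ s init′
             (All.lookup (after-initial-large (suc i) (p ++ [ ℓ ]) (s₁ ∷ s) perm′ (proj₁ init′)) (here refl)) avoids′
    ... | refl = glued-shape n i p s₁ s len-p perm′ avoids′ init′

module Counting where

  open Sums
  open Permutations
  open Avoidance
  open LeftToRightMinima using (avoiders; ∈-avoiders⁻; unique-avoiders; length-avoiders)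
  open Decomposable
  open import Data.Nat using (ℕ; zero; suc; _+_; _*_; _∸_; _≤_; _<_; s≤s; _<?_)
  open import Data.Nat.Properties using (_≟_; ≤-refl; ≤-pred; +-identityʳ; m+n∸n≡m; m∸n+n≡m; m≤n+m)
  open import Data.List using (List; []; _∷_; _++_; map; length; upTo; filter)
  open import Data.List.Relation.Unary.All as All using (All; []; _∷_)
  import Data.List.Relation.Unary.All.Properties as All
  open import Data.List.Membership.Propositional using (_∈_)
  open import Data.List.Membership.Propositional.Properties using (∈-filter⁺; ∈-filter⁻)
  import Data.List.Relation.Unary.Unique.Propositional.Properties as Unique
  open import Data.Product using (_×_; _,_; proj₁)
  open import Data.Empty using (⊥-elim)
  open import Relation.Nullary using (¬_; Dec; yes; no)
  open import Relation.Nullary.Decidable using (_×-dec_; ¬?)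
  open import Relation.Binary.PropositionalEquality using (_≡_; refl; sym; trans; cong; cong₂)
  open Relation.Binary.PropositionalEquality.≡-Reasoning

  des-++ : ∀ x xs y ys → All (y <_) (x ∷ xs) → des ((x ∷ xs) ++ y ∷ ys) ≡ des (x ∷ xs) + suc (des (y ∷ ys))
  des-++ x []        y ys (y<x ∷ _) with y <? x
  ... | yes _   = refl
  ... | no  y≮x = ⊥-elim (y≮x y<x)
  des-++ x (x′ ∷ xs) y ys (_ ∷ below) with x′ <? x
  ... | yes _ = cong suc (des-++ x′ xs y ys below)
  ... | no  _ = des-++ x′ xs y ys below

  des-shift : ∀ x τ → des (suc x ∷ map suc τ) ≡ des (x ∷ τ)
  des-shift x []      = refl
  des-shift x (y ∷ τ) with suc y <? suc x | y <? x
  ... | yes _   | yes _   = cong suc (des-shift y τ)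
  ... | no  _   | no  _   = des-shift y τ
  ... | yes y<x | no  y≮x = ⊥-elim (y≮x (≤-pred y<x))
  ... | no  y≮x | yes y<x = ⊥-elim (y≮x (s≤s y<x))

  des-map-suc : ∀ τ → des (map suc τ) ≡ des τ
  des-map-suc []      = refl
  des-map-suc (x ∷ τ) = des-shift x τ

  des-run : ∀ a m → des (run a (suc m)) ≡ m
  des-run a zero    = refl
  des-run a (suc m) with suc (m + a) <? suc (suc (m + a))
  ... | yes _     = cong suc (des-run a m)
  ... | no  not<  = ⊥-elim (not< ≤-refl)

  des-one-run : ∀ a m → des (1 ∷ run a (suc m)) ≡ m
  des-one-run a m with suc (m + a) <? 1
  ... | yes (s≤s ())
  ... | no  _ = des-run a m

  des-glue-[] : ∀ a → des (glue 0 (suc a) []) ≡ a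
  des-glue-[] a = des-one-run 1 a

  des-glue : ∀ j a t τ → All (1 ≤_) (t ∷ τ) → des (glue j (suc a) (t ∷ τ)) ≡ des (t ∷ τ) + suc a
  des-glue j a t τ positive = begin
    des (glue j (suc a) (t ∷ τ))                           ≡⟨ des-++ (suc t) (map suc τ) 1 (run (suc j) (suc a)) (All.map⁺ (All.map s≤s positive)) ⟩
    des (map suc (t ∷ τ)) + suc (des (1 ∷ run (suc j) (suc a)))  ≡⟨ cong₂ (λ x y → x + suc y) (des-map-suc (t ∷ τ)) (des-one-run (suc j) a) ⟩
    des (t ∷ τ) + suc a                                    ∎

  𝟙-× : ∀ {P Q : Set} (p : Dec P) (q : Dec Q) → 𝟙 (p ×-dec q) ≡ 𝟙 p * 𝟙 q
  𝟙-× (yes _) (yes _) = refl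
  𝟙-× (yes _) (no  _) = refl
  𝟙-× (no  _) _       = refl

  𝟙-split : ∀ {P Q : Set} (p : Dec P) (q : Dec Q) → 𝟙 p ≡ 𝟙 (p ×-dec q) + 𝟙 (p ×-dec ¬? q)
  𝟙-split (yes _) (yes _) = refl
  𝟙-split (yes _) (no  _) = refl
  𝟙-split (no  _) _       = refl

  𝟙-split-× : ∀ {P Q R : Set} (p : Dec P) (q : Dec Q) (r : Dec R) →
              𝟙 (p ×-dec r) ≡ 𝟙 ((p ×-dec q) ×-dec r) + 𝟙 (p ×-dec ¬? q) * 𝟙 r
  𝟙-split-× (yes _) (yes _) (yes _) = refl
  𝟙-split-× (yes _) (yes _) (no  _) = refl
  𝟙-split-× (yes _) (no  _) (yes _) = refl
  𝟙-split-× (yes _) (no  _) (no  _) = refl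
  𝟙-split-× (no  _) _       _       = refl

  𝟙-shift : ∀ x m i → m ≤ i → 𝟙 (x + m ≟ i) ≡ 𝟙 (x ≟ i ∸ m)
  𝟙-shift x m i m≤i with x + m ≟ i | x ≟ i ∸ m
  ... | yes _    | yes _ = refl
  ... | no  _    | no  _ = refl
  ... | yes refl | no  x≢ = ⊥-elim (x≢ (sym (m+n∸n≡m x m)))
  ... | no  x+m≢ | yes refl = ⊥-elim (x+m≢ (m∸n+n≡m m≤i))

  𝟙-shift-out : ∀ x m i → ¬ m ≤ i → 𝟙 (x + m ≟ i) ≡ 0
  𝟙-shift-out x m i m≰i with x + m ≟ i
  ... | yes refl = ⊥-elim (m≰i (m≤n+m m x))
  ... | no  _    = refl

  withDes : ℕ → List ℕ → ℕ
  withDes i π = 𝟙 (des π ≟ i)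

  Acount-avoiders : ∀ j i → Acount j i ≡ sumBy (withDes i) (avoiders j)
  Acount-avoiders j i = begin
    Acount j i                                                   ≡⟨ length-filter (λ π → avoids123? π ×-dec (des π ≟ i)) (perms j) ⟩
    sumBy (λ π → 𝟙 (avoids123? π ×-dec (des π ≟ i))) (perms j)   ≡⟨ sumBy-cong (perms j) (λ {π} _ → 𝟙-× (avoids123? π) (des π ≟ i)) ⟩
    sumBy (λ π → 𝟙 (avoids123? π) * withDes i π) (perms j)      ≡⟨ sym (sumBy-filter avoids123? (withDes i) (perms j)) ⟩
    sumBy (withDes i) (avoiders j)                               ∎

  decomposableAvoiders : ℕ → List (List ℕ)
  decomposableAvoiders n = filter (λ π → avoids123? π ×-dec ¬? (indecomposable? π)) (perms n)

  sum-decomposables : ∀ n (f : List ℕ → ℕ) → sumBy f (decomposableAvoiders (suc n)) ≡ sumBy f (decomposables (suc n))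
  sum-decomposables n f =
    sumBy-sameMembers f (Unique.filter⁺ _ (unique-perms (suc n))) (unique-decomposables (suc n)) to from
    where
    to : ∀ {π} → π ∈ decomposableAvoiders (suc n) → π ∈ decomposables (suc n)
    to π∈ with ∈-filter⁻ (λ π → avoids123? π ×-dec ¬? (indecomposable? π)) {xs = perms (suc n)} π∈
    ... | π∈′ , avoids , notIndec = decomposables-complete n (∈-perms⁻ π∈′) avoids notIndec
    from : ∀ {π} → π ∈ decomposables (suc n) → π ∈ decomposableAvoiders (suc n)
    from π∈ with decomposables-sound (suc n) π∈
    ... | p , avoids , notIndec = ∈-filter⁺ (λ π → avoids123? π ×-dec ¬? (indecomposable? π)) (∈-perms⁺ p) (avoids , notIndec)

  Acount-split : ∀ n i → Acount (suc n) i ≡ Icount (suc n) i + sumBy (withDes i) (decomposables (suc n))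
  Acount-split n i = begin
    Acount (suc n) i
      ≡⟨ length-filter (λ π → avoids123? π ×-dec (des π ≟ i)) (perms (suc n)) ⟩
    sumBy (λ π → 𝟙 (avoids123? π ×-dec (des π ≟ i))) (perms (suc n))
      ≡⟨ sumBy-cong (perms (suc n)) (λ {π} _ → 𝟙-split-× (avoids123? π) (indecomposable? π) (des π ≟ i)) ⟩
    sumBy (λ π → indec π + decomp π * withDes i π) (perms (suc n))
      ≡⟨ sumBy-+ indec (λ π → decomp π * withDes i π) (perms (suc n)) ⟩
    sumBy indec (perms (suc n)) + sumBy (λ π → decomp π * withDes i π) (perms (suc n))
      ≡⟨ cong₂ _+_ (sym (length-filter (λ π → (avoids123? π ×-dec indecomposable? π) ×-dec (des π ≟ i)) (perms (suc n))))
                   (sym (sumBy-filter (λ π → avoids123? π ×-dec ¬? (indecomposable? π)) (withDes i) (perms (suc n)))) ⟩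
    Icount (suc n) i + sumBy (withDes i) (decomposableAvoiders (suc n))
      ≡⟨ cong (Icount (suc n) i +_) (sum-decomposables n (withDes i)) ⟩
    Icount (suc n) i + sumBy (withDes i) (decomposables (suc n))
      ∎
    where
    indec decomp : List ℕ → ℕ
    indec π  = 𝟙 ((avoids123? π ×-dec indecomposable? π) ×-dec (des π ≟ i))
    decomp π = 𝟙 (avoids123? π ×-dec ¬? (indecomposable? π))

  Icount₁-split : ∀ n → Icount₁ (suc n) + length (decomposables (suc n)) ≡ bell (suc n)
  Icount₁-split n = begin
    Icount₁ (suc n) + length (decomposables (suc n))
      ≡⟨ cong₂ _+_ (length-filter (λ π → avoids123? π ×-dec indecomposable? π) (perms (suc n))) decomposables-count ⟩
    sumBy indec (perms (suc n)) + sumBy decomp (perms (suc n))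
      ≡⟨ sym (sumBy-+ indec decomp (perms (suc n))) ⟩
    sumBy (λ π → indec π + decomp π) (perms (suc n))
      ≡⟨ sym (sumBy-cong (perms (suc n)) (λ {π} _ → 𝟙-split (avoids123? π) (indecomposable? π))) ⟩
    sumBy (λ π → 𝟙 (avoids123? π)) (perms (suc n))
      ≡⟨ sym (length-filter avoids123? (perms (suc n))) ⟩
    length (avoiders (suc n))
      ≡⟨ length-avoiders (suc n) ⟩
    bell (suc n)
      ∎
    where
    indec decomp : List ℕ → ℕ
    indec π  = 𝟙 (avoids123? π ×-dec indecomposable? π)
    decomp π = 𝟙 (avoids123? π ×-dec ¬? (indecomposable? π))
    decomposables-count : length (decomposables (suc n)) ≡ sumBy decomp (perms (suc n))
    decomposables-count = begin
      length (decomposables (suc n))                      ≡⟨ sym (sumBy-one (decomposables (suc n))) ⟩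
      sumBy (λ _ → 1) (decomposables (suc n))             ≡⟨ sym (sum-decomposables n (λ _ → 1)) ⟩
      sumBy (λ _ → 1) (decomposableAvoiders (suc n))      ≡⟨ sumBy-one (decomposableAvoiders (suc n)) ⟩
      length (decomposableAvoiders (suc n))               ≡⟨ length-filter (λ π → avoids123? π ×-dec ¬? (indecomposable? π)) (perms (suc n)) ⟩
      sumBy decomp (perms (suc n))                        ∎

  sum-over-decomposables : ∀ n (f : List ℕ → ℕ) →
    sumBy f (decomposables (suc n)) ≡ sumBy (λ a → sumBy (λ τ → f (glue (n ∸ suc a) (suc a) τ)) (avoiders (n ∸ suc a))) (upTo n)
  sum-over-decomposables n f =
    trans (sumBy-concatMap f _ (upTo n))
          (sumBy-cong (upTo n) (λ {a} _ → sumBy-map f (glue (n ∸ suc a) (suc a)) (avoiders (n ∸ suc a))))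

  length-decomposables : ∀ n → length (decomposables (suc n)) ≡ sumBy (λ a → bell (n ∸ suc a)) (upTo n)
  length-decomposables n =
    trans (sym (sumBy-one (decomposables (suc n))))
    (trans (sum-over-decomposables n (λ _ → 1))
           (sumBy-cong (upTo n) (λ {a} _ → trans (sumBy-one (avoiders (n ∸ suc a))) (length-avoiders (n ∸ suc a)))))

  glueCount : ℕ → ℕ → ℕ → ℕ
  glueCount j a i = sumBy (λ τ → withDes i (glue j (suc a) τ)) (avoiders j)

  glueCount-0 : ∀ a i → glueCount 0 a i ≡ 𝟙 (a ≟ i)
  glueCount-0 a i = trans (cong (λ k → 𝟙 (k ≟ i) + 0) (des-glue-[] a)) (+-identityʳ _)

  des-glue-avoider : ∀ j a {τ} → τ ∈ avoiders (suc j) → des (glue (suc j) (suc a) τ) ≡ des τ + suc a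
  des-glue-avoider j a {τ} τ∈ with ∈-avoiders⁻ {suc j} τ∈
  des-glue-avoider j a {t ∷ τ} τ∈ | (_ , bounds , _) , _ = des-glue (suc j) a t τ (All.map proj₁ bounds)

  glueCount-in : ∀ j a i → suc a ≤ i → glueCount (suc j) a i ≡ Acount (suc j) (i ∸ suc a)
  glueCount-in j a i a<i =
    trans (sumBy-cong (avoiders (suc j))
             (λ {τ} τ∈ → trans (cong (λ k → 𝟙 (k ≟ i)) (des-glue-avoider j a τ∈)) (𝟙-shift (des τ) (suc a) i a<i)))
          (sym (Acount-avoiders (suc j) (i ∸ suc a)))

  glueCount-out : ∀ j a i → ¬ suc a ≤ i → glueCount (suc j) a i ≡ 0
  glueCount-out j a i a≮i =
    trans (sumBy-cong (avoiders (suc j))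
             (λ {τ} τ∈ → trans (cong (λ k → 𝟙 (k ≟ i)) (des-glue-avoider j a τ∈)) (𝟙-shift-out (des τ) (suc a) i a≮i)))
          (trans (sumBy-const 0 (avoiders (suc j))) refl)

module Series where

  open Sums using (sumBy)
  import Data.Nat as ℕ
  open import Data.Nat using (ℕ; zero; suc; _≤_; _<_; z≤n; s≤s; _∸_)
  import Data.Nat.Properties as ℕ
  open import Data.Integer using (ℤ; +_; _+_; _*_; -_)
  open import Data.Integer.Properties using (+-identityˡ; +-identityʳ; *-identityˡ; +-assoc; +-comm; *-comm; *-assoc; neg-distrib-+)
  open import Data.List using (applyUpTo)
  open import Data.Empty using (⊥-elim)
  open import Relation.Nullary using (yes; no)
  open import Relation.Binary.PropositionalEquality using (_≡_; _≢_; refl; sym; trans; cong; cong₂)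

  Σ≤-cong : ∀ n {f g : ℕ → ℤ} → (∀ k → k ≤ n → f k ≡ g k) → Σ≤ n f ≡ Σ≤ n g
  Σ≤-cong zero    f≡g = f≡g 0 z≤n
  Σ≤-cong (suc n) f≡g = cong₂ _+_ (Σ≤-cong n (λ k k≤n → f≡g k (ℕ.m≤n⇒m≤1+n k≤n))) (f≡g (suc n) ℕ.≤-refl)

  Σ≤-zero : ∀ n {f : ℕ → ℤ} → (∀ k → k ≤ n → f k ≡ + 0) → Σ≤ n f ≡ + 0
  Σ≤-zero zero    f≡0 = f≡0 0 z≤n
  Σ≤-zero (suc n) f≡0 = cong₂ _+_ (Σ≤-zero n (λ k k≤n → f≡0 k (ℕ.m≤n⇒m≤1+n k≤n))) (f≡0 (suc n) ℕ.≤-refl)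

  Σ≤-first : ∀ n (f : ℕ → ℤ) → Σ≤ (suc n) f ≡ f 0 + Σ≤ n (λ k → f (suc k))
  Σ≤-first zero    f = refl
  Σ≤-first (suc n) f = trans (cong (_+ f (suc (suc n))) (Σ≤-first n f)) (+-assoc (f 0) _ _)

  Σ≤-reverse : ∀ n (f : ℕ → ℤ) → Σ≤ n f ≡ Σ≤ n (λ k → f (n ∸ k))
  Σ≤-reverse zero    f = refl
  Σ≤-reverse (suc n) f = trans (cong (_+ f (suc n)) (Σ≤-reverse n f))
                               (trans (+-comm _ (f (suc n))) (sym (Σ≤-first n (λ k → f (suc n ∸ k)))))

  Σ≤-neg : ∀ n (f : ℕ → ℤ) → Σ≤ n (λ k → - f k) ≡ - Σ≤ n f
  Σ≤-neg zero    f = refl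
  Σ≤-neg (suc n) f = trans (cong (_+ - f (suc n)) (Σ≤-neg n f)) (sym (neg-distrib-+ (Σ≤ n f) (f (suc n))))

  Σ≤-sumBy : ∀ n (f : ℕ → ℤ) (g h : ℕ → ℕ) → (∀ k → k ≤ n → f k ≡ + g (h k)) → Σ≤ n f ≡ + sumBy g (applyUpTo h (suc n))
  Σ≤-sumBy zero    f g h f≡g = trans (f≡g 0 z≤n) (cong +_ (sym (ℕ.+-identityʳ _)))
  Σ≤-sumBy (suc n) f g h f≡g =
    trans (Σ≤-first n f)
          (cong₂ _+_ (f≡g 0 z≤n) (Σ≤-sumBy n (λ k → f (suc k)) g (λ k → h (suc k)) (λ k k≤n → f≡g (suc k) (s≤s k≤n))))

  δ-refl : ∀ n → δ n n ≡ + 1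
  δ-refl n with n ℕ.≟ n
  ... | yes _   = refl
  ... | no  n≢n = ⊥-elim (n≢n refl)

  δ-≢ : ∀ {m n} → m ≢ n → δ m n ≡ + 0
  δ-≢ {m} {n} m≢n with m ℕ.≟ n
  ... | yes m≡n = ⊥-elim (m≢n m≡n)
  ... | no  _   = refl

  δ-sym : ∀ m n → δ m n ≡ δ n m
  δ-sym m n with m ℕ.≟ n | n ℕ.≟ m
  ... | yes _   | yes _   = refl
  ... | no  _   | no  _   = refl
  ... | yes m≡n | no  n≢m = ⊥-elim (n≢m (sym m≡n))
  ... | no  m≢n | yes n≡m = ⊥-elim (m≢n (sym n≡m))

  Σ≤-δ-out : ∀ n c (f : ℕ → ℤ) → n < c → Σ≤ n (λ k → δ k c * f k) ≡ + 0
  Σ≤-δ-out n c f n<c = Σ≤-zero n (λ k k≤n → cong (_* f k) (δ-≢ (λ k≡c → ℕ.<-irrefl k≡c (ℕ.≤-<-trans k≤n n<c))))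

  Σ≤-δ-in : ∀ n c (f : ℕ → ℤ) → c ≤ n → Σ≤ n (λ k → δ k c * f k) ≡ f c
  Σ≤-δ-in zero zero f z≤n = trans (cong (_* f 0) (δ-refl 0)) (*-identityˡ (f 0))
  Σ≤-δ-in (suc n) c f c≤ with c ℕ.≟ suc n
  ... | yes refl = trans (cong₂ _+_ (Σ≤-δ-out n (suc n) f ℕ.≤-refl) (cong (_* f (suc n)) (δ-refl (suc n))))
                         (trans (+-identityˡ _) (*-identityˡ (f (suc n))))
  ... | no  c≢   = trans (cong₂ _+_ (Σ≤-δ-in n c f (ℕ.≤-pred (ℕ.≤∧≢⇒< c≤ c≢)))
                                     (cong (_* f (suc n)) (δ-≢ (λ n+1≡c → c≢ (sym n+1≡c)))))
                         (+-identityʳ (f c))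

  mono : ℕ → ℕ → FPS₂
  mono p r n i = δ n p * δ i r

  mono-coefficient : ∀ p r (F : FPS₂) n i a →
    Σ≤ i (λ b → (δ a p * δ b r) * F (n ∸ a) (i ∸ b)) ≡ Σ≤ i (λ b → δ b r * (δ a p * F (n ∸ a) (i ∸ b)))
  mono-coefficient p r F n i a = Σ≤-cong i (λ b _ → trans (cong (_* F (n ∸ a) (i ∸ b)) (*-comm (δ a p) (δ b r))) (*-assoc (δ b r) (δ a p) _))

  mono-⊛-in : ∀ p r (F : FPS₂) n i → p ≤ n → r ≤ i → (mono p r ⊛₂ F) n i ≡ F (n ∸ p) (i ∸ r)
  mono-⊛-in p r F n i p≤n r≤i =
    trans (Σ≤-cong n (λ a _ → trans (mono-coefficient p r F n i a) (Σ≤-δ-in i r (λ b → δ a p * F (n ∸ a) (i ∸ b)) r≤i)))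
          (Σ≤-δ-in n p (λ a → F (n ∸ a) (i ∸ r)) p≤n)

  mono-⊛-outˣ : ∀ p r (F : FPS₂) n i → n < p → (mono p r ⊛₂ F) n i ≡ + 0
  mono-⊛-outˣ p r F n i n<p =
    Σ≤-zero n (λ a a≤n → Σ≤-zero i (λ b _ →
      cong (λ d → (d * δ b r) * F (n ∸ a) (i ∸ b)) (δ-≢ (λ a≡p → ℕ.<-irrefl a≡p (ℕ.≤-<-trans a≤n n<p)))))

  mono-⊛-outᵠ : ∀ p r (F : FPS₂) n i → i < r → (mono p r ⊛₂ F) n i ≡ + 0
  mono-⊛-outᵠ p r F n i i<r =
    Σ≤-zero n (λ a _ → trans (mono-coefficient p r F n i a) (Σ≤-δ-out i r (λ b → δ a p * F (n ∸ a) (i ∸ b)) i<r))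

  -- Multiplication by a monomial commutes (by reversing both summations).
  ⊛-mono : ∀ p r (F : FPS₂) n i → (F ⊛₂ mono p r) n i ≡ (mono p r ⊛₂ F) n i
  ⊛-mono p r F n i =
    trans (Σ≤-reverse n _)
    (Σ≤-cong n (λ a a≤n → trans (Σ≤-reverse i _) (Σ≤-cong i (λ b b≤i →
       trans (*-comm (F (n ∸ a) (i ∸ b)) _)
             (cong (λ t → t * F (n ∸ a) (i ∸ b)) (cong₂ (λ u v → δ u p * δ v r) (ℕ.m∸[m∸n]≡n a≤n) (ℕ.m∸[m∸n]≡n b≤i)))))))

-- The coefficient of x^{n+1} q^i of the last term is Σ_{a<n} glueCount (n-1-a) a i,
-- the number of decomposable avoiders of [n+1] with i descents.
module FirstEquation where

  open Sums using (sumBy; 𝟙)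
  open Counting using (glueCount; glueCount-0; glueCount-in; glueCount-out; Acount-split; sum-over-decomposables)
  open Series
  open import Data.Nat using (ℕ; zero; suc; _≤_; _<_; z≤n; s≤s; _≤?_; _∸_; pred)
  import Data.Nat.Properties as ℕ
  open import Data.Integer using (ℤ; +_; _+_; _*_; _-_)
  open import Data.Integer.Properties using (+-identityˡ; +-identityʳ; *-identityˡ; *-zeroʳ; +-inverseʳ)
  open import Data.List using (upTo)
  open import Data.Empty using (⊥-elim)
  open import Relation.Nullary using (Dec; yes; no)
  open import Relation.Binary.PropositionalEquality using (_≡_; refl; sym; trans; cong; cong₂)

  A-1 G x/[1-xq] : FPS₂
  A-1      = Agf ⊖₂ one₂
  G        = A-1 ⊛₂ X₂ ⊛₂ Q₂ ⊕₂ X₂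
  x/[1-xq] = X₂ ⊛₂ inv1-xq

  A-1-zero : ∀ e → A-1 0 e ≡ + 0
  A-1-zero e = trans (cong (δ e 0 -_) (*-identityˡ (δ e 0))) (+-inverseʳ (δ e 0))

  A-1-suc : ∀ j e → A-1 (suc j) e ≡ + Acount (suc j) e
  A-1-suc j e = +-identityʳ _

  ·x-zero : ∀ (F : FPS₂) d → (F ⊛₂ X₂) 0 d ≡ + 0
  ·x-zero F d = trans (⊛-mono 1 0 F 0 d) (mono-⊛-outˣ 1 0 F 0 d (s≤s z≤n))

  ·x-suc : ∀ (F : FPS₂) c d → (F ⊛₂ X₂) (suc c) d ≡ F c d
  ·x-suc F c d = trans (⊛-mono 1 0 F (suc c) d) (mono-⊛-in 1 0 F (suc c) d (s≤s z≤n) z≤n)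

  ·q-zero : ∀ (F : FPS₂) c → (F ⊛₂ Q₂) c 0 ≡ + 0
  ·q-zero F c = trans (⊛-mono 0 1 F c 0) (mono-⊛-outᵠ 0 1 F c 0 (s≤s z≤n))

  ·q-suc : ∀ (F : FPS₂) c d → (F ⊛₂ Q₂) c (suc d) ≡ F c d
  ·q-suc F c d = trans (⊛-mono 0 1 F c (suc d)) (mono-⊛-in 0 1 F c (suc d) z≤n (s≤s z≤n))

  G-zero : ∀ d → G 0 d ≡ + 0
  G-zero zero    = cong (_+ + 0) (·q-zero (A-1 ⊛₂ X₂) 0)
  G-zero (suc d) = cong (_+ + 0) (trans (·q-suc (A-1 ⊛₂ X₂) 0 d) (·x-zero A-1 d))

  G-one : ∀ d → G 1 d ≡ δ d 0
  G-one d = trans (cong (_+ (+ 1 * δ d 0)) (xq-part d)) (trans (+-identityˡ _) (*-identityˡ (δ d 0)))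
    where
    xq-part : ∀ d → (A-1 ⊛₂ X₂ ⊛₂ Q₂) 1 d ≡ + 0
    xq-part zero    = ·q-zero (A-1 ⊛₂ X₂) 1
    xq-part (suc d) = trans (·q-suc (A-1 ⊛₂ X₂) 1 d) (trans (·x-suc A-1 0 d) (A-1-zero d))

  G-suc-suc-zero : ∀ j → G (suc (suc j)) 0 ≡ + 0
  G-suc-suc-zero j = cong (_+ + 0) (·q-zero (A-1 ⊛₂ X₂) (suc (suc j)))

  G-suc-suc-suc : ∀ j d → G (suc (suc j)) (suc d) ≡ + Acount (suc j) d
  G-suc-suc-suc j d = trans (+-identityʳ _) (trans (·q-suc (A-1 ⊛₂ X₂) (suc (suc j)) d) (trans (·x-suc A-1 (suc j) d) (A-1-suc j d)))

  δ-𝟙 : ∀ a i → a ≤ i → δ (i ∸ a) 0 ≡ + 𝟙 (a ℕ.≟ i)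
  δ-𝟙 a i a≤i with a ℕ.≟ i
  ... | yes refl = trans (cong (λ t → δ t 0) (ℕ.n∸n≡0 a)) (δ-refl 0)
  ... | no  a≢i  = δ-≢ (λ i∸a≡0 → a≢i (ℕ.≤-antisym a≤i (ℕ.m∸n≡0⇒m≤n i∸a≡0)))

  G-glue : ∀ j a i → a ≤ i → G (suc j) (i ∸ a) ≡ + glueCount j a i
  G-glue zero a i a≤i = trans (G-one (i ∸ a)) (trans (δ-𝟙 a i a≤i) (cong +_ (sym (glueCount-0 a i))))
  G-glue (suc j) a i a≤i with i ∸ a in i∸a≡
  ... | zero  = trans (G-suc-suc-zero j) (cong +_ (sym (glueCount-out j a i (λ a<i → ℕ.m>n⇒m∸n≢0 a<i i∸a≡))))
  ... | suc d = trans (G-suc-suc-suc j d) (cong +_ (sym (trans (glueCount-in j a i a<i) (cong (Acount (suc j)) i∸[a+1]≡d))))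
    where
    a<i : suc a ≤ i
    a<i = ℕ.m∸n≢0⇒n<m (λ i∸a≡0 → ℕ.0≢1+n (trans (sym i∸a≡0) i∸a≡))
    i∸[a+1]≡d : i ∸ suc a ≡ d
    i∸[a+1]≡d = trans (sym (ℕ.pred[m∸n]≡m∸[1+n] i a)) (cong pred i∸a≡)

  glueCount-below : ∀ j a i → i < a → glueCount j a i ≡ 0
  glueCount-below zero    a i i<a = trans (glueCount-0 a i) (𝟙-≢ (a ℕ.≟ i))
    where
    𝟙-≢ : (d : Dec (a ≡ i)) → 𝟙 d ≡ 0
    𝟙-≢ (yes refl) = ⊥-elim (ℕ.<-irrefl refl i<a)
    𝟙-≢ (no  _)    = refl
  glueCount-below (suc j) a i i<a = glueCount-out j a i (ℕ.<-asym i<a)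

  -- shiftedG c a i = [a ≤ i] · G c (i-a), the coefficient of x^{c+a+1} q^i in x^{a+1} q^a · G.
  shiftedG : ℕ → ℕ → ℕ → ℤ
  shiftedG c a i = Σ≤ i (λ b → δ a b * G c (i ∸ b))

  shiftedG-glue : ∀ j a i → shiftedG (suc j) a i ≡ + glueCount j a i
  shiftedG-glue j a i with a ≤? i
  ... | yes a≤i = trans (Σ≤-cong i (λ b _ → cong (_* G (suc j) (i ∸ b)) (δ-sym a b)))
                        (trans (Σ≤-δ-in i a (λ b → G (suc j) (i ∸ b)) a≤i) (G-glue j a i a≤i))
  ... | no  a≰i = trans (Σ≤-cong i (λ b _ → cong (_* G (suc j) (i ∸ b)) (δ-sym a b)))
                        (trans (Σ≤-δ-out i a (λ b → G (suc j) (i ∸ b)) (ℕ.≰⇒> a≰i)) (cong +_ (sym (glueCount-below j a i (ℕ.≰⇒> a≰i)))))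

  shiftedG-zero : ∀ a i → shiftedG 0 a i ≡ + 0
  shiftedG-zero a i = Σ≤-zero i (λ b _ → trans (cong (δ a b *_) (G-zero (i ∸ b))) (*-zeroʳ (δ a b)))

  x/[1-xq]-zero : ∀ b → x/[1-xq] 0 b ≡ + 0
  x/[1-xq]-zero b = mono-⊛-outˣ 1 0 inv1-xq 0 b (s≤s z≤n)

  x/[1-xq]-suc : ∀ a b → x/[1-xq] (suc a) b ≡ δ a b
  x/[1-xq]-suc a b = mono-⊛-in 1 0 inv1-xq (suc a) b (s≤s z≤n) z≤n

  x/[1-xq]·G-suc : ∀ n i → (x/[1-xq] ⊛₂ G) (suc n) i ≡ Σ≤ n (λ a → shiftedG (n ∸ a) a i)
  x/[1-xq]·G-suc n i =
    trans (Σ≤-first n _)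
          (trans (cong₂ _+_ (Σ≤-zero i (λ b _ → cong (_* G (suc n) (i ∸ b)) (x/[1-xq]-zero b)))
                            (Σ≤-cong n (λ a _ → Σ≤-cong i (λ b _ → cong (_* G (n ∸ a) (i ∸ b)) (x/[1-xq]-suc a b)))))
                 (+-identityˡ _))

  x/[1-xq]·G : ∀ n i → (x/[1-xq] ⊛₂ G) (suc n) i ≡ + sumBy (λ a → glueCount (n ∸ suc a) a i) (upTo n)
  x/[1-xq]·G zero    i = trans (x/[1-xq]·G-suc 0 i) (shiftedG-zero 0 i)
  x/[1-xq]·G (suc m) i =
    trans (x/[1-xq]·G-suc (suc m) i)
          (trans (cong₂ _+_ (Σ≤-sumBy m _ (λ a → glueCount (m ∸ a) a i) (λ a → a)
                               (λ a a≤m → trans (cong (λ c → shiftedG c a i) (ℕ.+-∸-assoc 1 a≤m)) (shiftedG-glue (m ∸ a) a i)))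
                            (trans (cong (λ c → shiftedG c (suc m) i) (ℕ.n∸n≡0 m)) (shiftedG-zero (suc m) i)))
                 (+-identityʳ _))

  -- Constant terms agree; at x^{n+1} q^i this is Acount-split.
  first-equation : Agf ≋₂ (one₂ ⊕₂ Igf ⊕₂ x/[1-xq] ⊛₂ G)
  first-equation zero    i =
    sym (trans (cong₂ _+_ (trans (cong (_+ + 0) (*-identityˡ (δ i 0))) (+-identityʳ (δ i 0)))
                          (Σ≤-zero i (λ b _ → cong (_* G 0 (i ∸ b)) (x/[1-xq]-zero b))))
               (+-identityʳ (δ i 0)))
  first-equation (suc n) i =
    trans (cong +_ (Acount-split n i))
          (cong (λ t → + Icount (suc n) i + t) (sym (trans (x/[1-xq]·G n i) (cong +_ (sym (sum-over-decomposables n _))))))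

-- The second identity I(x) = (1-x-x²)/(1-x) · B(x) - 1 is the generating-function form of
-- the recurrence I_n = B_n - Σ_{i ≤ n-2} B_i, which in turn says that the decomposable
-- avoiders of [n] are counted by Σ_{i ≤ n-2} B_i.
module SecondEquation where

  open Counting using (Icount₁-split; length-decomposables)
  open Decomposable using (decomposables)
  open Series
  open import Data.Nat using (ℕ; zero; suc; _≤_; z≤n; s≤s; _∸_)
  open import Data.Integer using (ℤ; +_; _+_; _*_; -_; _-_; -1ℤ)
  open import Data.Integer.Properties using (+-identityˡ; +-identityʳ; *-identityˡ; +-assoc; +-inverseʳ; -1*i≡-i)
  open import Data.List using (length; upTo)
  open Sums using (sumBy)
  open import Relation.Binary.PropositionalEquality using (_≡_; refl; sym; trans; cong; cong₂)
  open Relation.Binary.PropositionalEquality.≡-Reasoning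

  bell-partial-sum : ∀ m → Σ≤ m (λ i → + bell i) ≡ + length (decomposables (suc (suc m)))
  bell-partial-sum m = begin
    Σ≤ m (λ i → + bell i)                                        ≡⟨ Σ≤-reverse m (λ i → + bell i) ⟩
    Σ≤ m (λ k → + bell (m ∸ k))                                  ≡⟨ Σ≤-sumBy m _ (λ a → bell (m ∸ a)) (λ a → a) (λ _ _ → refl) ⟩
    + sumBy (λ a → bell (m ∸ a)) (upTo (suc m))                 ≡⟨ cong +_ (sym (length-decomposables (suc m))) ⟩
    + length (decomposables (suc (suc m)))                       ∎

  cancelʳ : ∀ x y → (x + y) - y ≡ x
  cancelʳ x y = trans (+-assoc x y (- y)) (trans (cong (λ t → x + t) (+-inverseʳ y)) (+-identityʳ x))

  indecomposables-recurrence : ∀ (n : ℕ) → 2 ≤ n → + Icount₁ n ≡ + bell n - Σ≤ (n ∸ 2) (λ i → + bell i)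
  indecomposables-recurrence (suc (suc m)) (s≤s (s≤s z≤n)) = begin
    + Icount₁ (suc (suc m))                                            ≡⟨ sym (cancelʳ _ (+ length (decomposables (suc (suc m))))) ⟩
    + Icount₁ (suc (suc m)) + + length (decomposables (suc (suc m))) - + length (decomposables (suc (suc m)))
                                                                       ≡⟨ cong₂ _-_ (cong +_ (Icount₁-split (suc m))) (sym (bell-partial-sum m)) ⟩
    + bell (suc (suc m)) - Σ≤ m (λ i → + bell i)                       ∎

  -- (1 - x - x²)/(1 - x) = 1 - x² - x³ - …
  C : FPS₁
  C = (one₁ ⊖₁ X₁ ⊖₁ X₁ ⊛₁ X₁) ⊛₁ inv1-x

  x²-high : ∀ k → (X₁ ⊛₁ X₁) (suc (suc (suc k))) ≡ + 0
  x²-high k = Σ≤-δ-in (suc (suc (suc k))) 1 (λ t → δ (suc (suc (suc k)) ∸ t) 1) (s≤s z≤n)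

  C-high : ∀ k → C (suc (suc k)) ≡ -1ℤ
  C-high zero    = refl
  C-high (suc k) = cong₂ _+_ (C-high k) (cong (λ t → (+ 0 - t) * + 1) (x²-high k))

  -- Coefficientwise: 0 = 1 - 1, I_1 = B_1 - 0 and I_{m+2} = B_{m+2} - Σ_{k ≤ m} B_k.
  second-equation : Igf₁ ≋₁ (C ⊛₁ Bgf ⊖₁ one₁)
  second-equation zero          = refl
  second-equation (suc zero)    = refl
  second-equation (suc (suc m)) = trans (indecomposables-recurrence (suc (suc m)) (s≤s (s≤s z≤n))) (sym (begin
    (C ⊛₁ Bgf) (suc (suc m)) - one₁ (suc (suc m))
      ≡⟨ +-identityʳ _ ⟩
    Σ≤ (suc (suc m)) F
      ≡⟨ Σ≤-first (suc m) F ⟩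
    F 0 + Σ≤ (suc m) (λ k → F (suc k))
      ≡⟨ cong (λ t → F 0 + t) (Σ≤-first m (λ k → F (suc k))) ⟩
    F 0 + (F 1 + Σ≤ m (λ k → F (suc (suc k))))
      ≡⟨ cong₂ _+_ (*-identityˡ (+ bell (suc (suc m)))) (+-identityˡ (Σ≤ m (λ k → F (suc (suc k))))) ⟩
    + bell (suc (suc m)) + Σ≤ m (λ k → F (suc (suc k)))
      ≡⟨ cong (λ t → + bell (suc (suc m)) + t) tail-sum ⟩
    + bell (suc (suc m)) - Σ≤ m (λ i → + bell i)
      ∎))
    where
    F : ℕ → ℤ
    F a = C a * Bgf (suc (suc m) ∸ a)
    tail-sum : Σ≤ m (λ k → F (suc (suc k))) ≡ - Σ≤ m (λ i → + bell i)
    tail-sum = begin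
      Σ≤ m (λ k → F (suc (suc k)))        ≡⟨ Σ≤-cong m (λ k _ → trans (cong (_* + bell (m ∸ k)) (C-high k)) (-1*i≡-i _)) ⟩
      Σ≤ m (λ k → - + bell (m ∸ k))       ≡⟨ Σ≤-neg m (λ k → + bell (m ∸ k)) ⟩
      - Σ≤ m (λ k → + bell (m ∸ k))       ≡⟨ cong -_ (sym (Σ≤-reverse m (λ i → + bell i))) ⟩
      - Σ≤ m (λ i → + bell i)             ∎

open import Data.Nat using (ℕ; _≤_)
open import Data.Integer using (+_; _-_)
open import Data.Product using (_×_; _,_)
open import Relation.Binary.PropositionalEquality using (_≡_; refl)

theorem4p2 : (Agf ≋₂ (one₂ ⊕₂ Igf ⊕₂ (X₂ ⊛₂ inv1-xq) ⊛₂ ((Agf ⊖₂ one₂) ⊛₂ X₂ ⊛₂ Q₂ ⊕₂ X₂)))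
    × (Igf₁ ≋₁ ((one₁ ⊖₁ X₁ ⊖₁ X₁ ⊛₁ X₁) ⊛₁ inv1-x ⊛₁ Bgf ⊖₁ one₁))
    × (Icount₁ 1 ≡ 1)
    × (∀ (n : ℕ) → 2 ≤ n → + Icount₁ n ≡ + bell n - Σ≤ (n Data.Nat.∸ 2) (λ i → + bell i))
theorem4p2 =
    FirstEquation.first-equation
  , SecondEquation.second-equation
  , refl
  , SecondEquation.indecomposables-recurrence
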